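{- Let $T$ be a tree of order $n \geq 4$ with $\Delta(T) \geq 3$ such that $d(u,v) \leq n/2$ for all $u,v \in V(T)$. Then $$\mathrm{hc}(T) = (n-1)(n-1-\zeta(T)) + \zeta'(T) - 2\mathcal{L}_W(T)$$ holds if and only if there exists an ordering $x_0, x_1, \ldots, x_{n-1}$ of the vertices of $T$ such that for all $0 \leq i \leq n-2$: (a) $\mathcal{L}(x_0) + \mathcal{L}(x_{n-1}) = 1$ when $W(T) = \{w\}$, and $\mathcal{L}(x_0) + \mathcal{L}(x_{n-1}) = 0$ when $W(T) = \{w,w'\}$; (b) $x_i$ and $x_{i+1}$ are in different branches when $W(T) = \{w\}$, and in opposite branches when $W(T) = \{w,w'\}$. Moreover, under these conditions the mapping $h$ defined by $h(x_0)=0$ and $h(x_{i+1}) = h(x_i) + n-1-\zeta(T)-\mathcal{L}(x_i)-\mathcal{L}(x_{i+1})$ ($0\le i\le n-2$) is an optimal hamiltonian coloring of $T$.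
   Context: For a connected graph $G$ of order $n$, the detour distance $D(u,v)$ is the length of a longest $u$–$v$ path (in a tree it equals the ordinary distance $d(u,v)$). A hamiltonian coloring of $G$ is a map $h: V(G) \to \{0,1,2,\ldots\}$ with $D(u,v) + |h(u)-h(v)| \geq n-1$ for all distinct $u,v$; its span is $\max\{|h(u)-h(v)|\}$, $\mathrm{hc}(G)$ is the minimum span, and an optimal hamiltonian coloring is one of span $\mathrm{hc}(G)$. For a tree $T$ let $w_T(v) = \sum_u d(u,v)$; weight centers are the minimizers of $w_T$, and $W(T)$ is their set (one vertex $w$, or two adjacent vertices $w,w'$). $\zeta(T)=0$ if $|W(T)|=1$, $\zeta(T)=1$ if $|W(T)|=2$, $\zeta'(T)=1-\zeta(T)$. $\mathcal{L}(u)=\min\{D(u,x):x\in W(T)\}$, $\mathcal{L}_W(T)=\sum_u\mathcal{L}(u)$. Branch terminology: when $W(T)=\{w\}$, distinct vertices $u,v$ are "in different branches" if $w$ lies on the $u$–$v$ path ($u$ or $v$ may be $w$); when $W(T)=\{w,w'\}$, $u,v$ are "in opposite branches" if the $u$–$v$ path contains the edge $ww'$. -}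

module Defs where

open import Data.Nat using (ℕ; zero; suc; _+_; _*_; _∸_; _≤_; _≤?_; _⊔_; _⊓_; ∣_-_∣)
open import Data.Nat.ListAction using (sum)
open import Data.Bool using (Bool; true; false; T)
open import Data.Fin using (Fin; toℕ)
open import Data.Fin.Properties using (all?)
open import Data.List using (List; []; _∷_; _++_; [_]; length; head; last; map; foldr; filter; allFin; concatMap)
open import Data.List.Relation.Unary.Linked using (Linked)
open import Data.List.Relation.Unary.Unique.Propositional using (Unique)
open import Data.List.Membership.Propositional using (_∈_)
open import Data.Maybe using (Maybe; just)
open import Data.Product using (Σ; ∃; _×_; _,_)
open import Data.Sum using (_⊎_)
open import Relation.Binary.PropositionalEquality using (_≡_; _≢_)
open import Relation.Nullary using (¬_)
open import Function.Definitions using (Bijective)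

Graph : ℕ → Set
Graph n = Fin n → Fin n → Bool

module _ {n : ℕ} (G : Graph n) where

  Adj : Fin n → Fin n → Set
  Adj u v = T (G u v)

  IsSimple : Set
  IsSimple = (∀ u → G u u ≡ false) × (∀ u v → G u v ≡ G v u)

  record Path (u v : Fin n) : Set where
    field
      verts    : List (Fin n)
      linked   : Linked Adj verts
      distinct : Unique verts
      starts   : head verts ≡ just u
      ends     : last verts ≡ just v

  len : ∀ {u v} → Path u v → ℕ
  len p = length (Path.verts p) ∸ 1

  Cycle : Set
  Cycle = Σ (List (Fin n)) λ cs → (3 ≤ length cs) × Unique cs ×
            Σ (Fin n) (λ a → (head cs ≡ just a) × Linked Adj (cs ++ [ a ]))

  Connected : Set
  Connected = ∀ u v → Path u v

  IsTree : Set
  IsTree = IsSimple × Connected × ¬ Cycle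

  MaxDegree≥3 : Set
  MaxDegree≥3 = Σ (Fin n) λ v → Σ (Fin n) λ a → Σ (Fin n) λ b → Σ (Fin n) λ c →
                  Adj v a × Adj v b × Adj v c × a ≢ b × a ≢ c × b ≢ c

  IsDistance : (Fin n → Fin n → ℕ) → Set
  IsDistance d = ∀ u v → Σ (Path u v) (λ p → len p ≡ d u v) × (∀ (p : Path u v) → d u v ≤ len p)

  IsDetour : (Fin n → Fin n → ℕ) → Set
  IsDetour D = ∀ u v → Σ (Path u v) (λ p → len p ≡ D u v) × (∀ (p : Path u v) → len p ≤ D u v)

  IsHamColoring : (D : Fin n → Fin n → ℕ) → (Fin n → ℕ) → Set
  IsHamColoring D h = ∀ u v → u ≢ v → n ∸ 1 ≤ D u v + ∣ h u - h v ∣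

  span : (Fin n → ℕ) → ℕ
  span h = foldr _⊔_ 0 (concatMap (λ u → map (λ v → ∣ h u - h v ∣) (allFin n)) (allFin n))

  IsHC : (D : Fin n → Fin n → ℕ) → ℕ → Set
  IsHC D k = (Σ (Fin n → ℕ) λ h → IsHamColoring D h × span h ≡ k)
           × (∀ h → IsHamColoring D h → k ≤ span h)

  IsOptimalHamColoring : (D : Fin n → Fin n → ℕ) → (Fin n → ℕ) → Set
  IsOptimalHamColoring D h = IsHamColoring D h × (∀ h' → IsHamColoring D h' → span h ≤ span h')

  module _ (d : Fin n → Fin n → ℕ) where

    weight : Fin n → ℕ
    weight v = sum (map (λ u → d u v) (allFin n))

    IsWeightCenter : Fin n → Set
    IsWeightCenter v = ∀ u → weight v ≤ weight u

    centers : List (Fin n)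
    centers = filter (λ v → all? (λ u → weight v ≤? weight u)) (allFin n)

    ζ : ℕ
    ζ = length centers ∸ 1

    ζ' : ℕ
    ζ' = 1 ∸ ζ

    -- 𝓛(u) = min { D(u,x) : x ∈ W(T) } (D = detour distance; the seed n
    -- exceeds every D(u,x) and W(T) is nonempty, so this is the minimum)
    𝓛 : (D : Fin n → Fin n → ℕ) → Fin n → ℕ
    𝓛 D u = foldr (λ x m → D u x ⊓ m) n centers

    𝓛W : (D : Fin n → Fin n → ℕ) → ℕ
    𝓛W D = sum (map (𝓛 D) (allFin n))

  -- W(T) = {w}: u, v in different branches iff w lies on the u–v path
  DifferentBranches : Fin n → Fin n → Fin n → Set
  DifferentBranches w u v = u ≢ v × Σ (Path u v) (λ p → w ∈ Path.verts p)

  ContainsEdge : Fin n → Fin n → List (Fin n) → Set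
  ContainsEdge a b xs = Σ (List (Fin n)) λ pre → Σ (List (Fin n)) λ suf →
                          (xs ≡ pre ++ a ∷ b ∷ suf) ⊎ (xs ≡ pre ++ b ∷ a ∷ suf)

  -- W(T) = {w,w'}: u, v in opposite branches iff the u–v path contains the edge ww'
  OppositeBranches : Fin n → Fin n → Fin n → Fin n → Set
  OppositeBranches w w' u v = Σ (Path u v) (λ p → ContainsEdge w w' (Path.verts p))

  module _ (d D : Fin n → Fin n → ℕ) where

    OrderingConditions : (Fin n → Fin n) → Set
    OrderingConditions x =
      Bijective _≡_ _≡_ x ×
      (∀ i j → toℕ i ≡ 0 → toℕ j ≡ n ∸ 1 →
         (ζ d ≡ 0 → 𝓛 d D (x i) + 𝓛 d D (x j) ≡ 1) ×
         (ζ d ≡ 1 → 𝓛 d D (x i) + 𝓛 d D (x j) ≡ 0)) ×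
      (∀ i j → toℕ j ≡ suc (toℕ i) →
         (∀ w → ζ d ≡ 0 → IsWeightCenter d w → DifferentBranches w (x i) (x j)) ×
         (∀ w w' → ζ d ≡ 1 → IsWeightCenter d w → IsWeightCenter d w' → w ≢ w' →
            OppositeBranches w w' (x i) (x j)))

    -- h(x_0) = 0 and h(x_{i+1}) = h(x_i) + n - 1 - ζ - 𝓛(x_i) - 𝓛(x_{i+1})
    -- (written additively, as an equation of integers, to avoid truncated subtraction)
    ColoringFromOrdering : (Fin n → Fin n) → (Fin n → ℕ) → Set
    ColoringFromOrdering x h =
      (∀ i → toℕ i ≡ 0 → h (x i) ≡ 0) ×
      (∀ i j → toℕ j ≡ suc (toℕ i) →
         h (x j) + ζ d + 𝓛 d D (x i) + 𝓛 d D (x j) ≡ h (x i) + (n ∸ 1))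

-- In a tree the detour distance is the ordinary distance d. The total distance w_T is strictly
-- convex along paths, so the weight centres are one vertex or two adjacent ones, and
-- d(u,v) ≤ 𝓛(u) + 𝓛(v) + ζ(T), with equality exactly when u and v lie in different (opposite)
-- branches. Listing the vertices of a hamiltonian colouring h by increasing colour, consecutive
-- colours differ by at least n−1−d(x_i,x_{i+1}) ≥ n−1−ζ(T) − 𝓛(x_i) − 𝓛(x_{i+1}); summing,
-- span h ≥ (n−1)(n−1−ζ(T)) − 2𝓛_W(T) + 𝓛(x_0) + 𝓛(x_{n−1}) ≥ (n−1)(n−1−ζ(T)) + ζ′(T) − 2𝓛_W(T),
-- with equality iff every step is tight, which is (b), and the ends satisfy (a). Conversely, along
-- such an ordering the colouring with gaps n−1−d(x_i,x_{i+1}) attains this bound, and it is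
-- hamiltonian because 2d ≤ n makes every gap positive and any two consecutive gaps sum to ≥ n−2.

module Submission where

open import Defs
open import Data.Bool using (T; true; false; if_then_else_)
open import Data.Empty using (⊥-elim)
open import Data.Fin using (Fin; toℕ; cast; fromℕ<) renaming (zero to fzero; suc to fsuc)
open import Data.Fin.Properties using (_≟_; all?; toℕ-injective; toℕ-cast; cast-involutive; toℕ-fromℕ<)
open import Data.List using (List; []; _∷_; _++_; _∷ʳ_; length; head; last; reverse; map; foldr; allFin;
  concatMap; lookup; tabulate)
open import Data.List.Extrema.Nat using (argmin; f[argmin]≤f[xs])
open import Data.List.Membership.Propositional using (_∈_; _∉_)
open import Data.List.Membership.Propositional.Properties
  using (∈-∃++; ∈-++⁺ʳ; ∈-++⁺ˡ; ∈-++⁻; ∈-allFin; ∈-filter⁺; ∈-filter⁻; ∈-lookup; ∈-tabulate⁺;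
         ∈-map⁺; ∈-map⁻; ∈-concatMap⁺; ∈-concatMap⁻)
open import Data.List.Membership.Propositional.Properties.WithK using (unique∧set⇒bag)
open import Data.List.Properties
  using (unfold-reverse; reverse-involutive; ++-identityʳ; length-++; length-reverse; ++-assoc;
         length-tabulate; lookup-tabulate; ∷-injectiveʳ)
open import Data.List.Relation.Binary.BagAndSetEquality using (∼bag⇒↭)
open import Data.List.Relation.Binary.Permutation.Propositional using (_↭_; ↭-sym; ↭⇒↭ₛ)
open import Data.List.Relation.Binary.Permutation.Propositional.Properties
  using (↭-reverse; ↭-length; map⁺; ∈-resp-↭)
import Data.List.Relation.Binary.Permutation.Setoid.Properties as Perm
open import Data.List.Relation.Binary.Subset.Propositional using (_⊆_)
open import Data.List.Relation.Unary.All as All using (All; []; _∷_)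
open import Data.List.Relation.Unary.All.Properties using (¬Any⇒All¬; ++⁻ˡ)
open import Data.List.Relation.Unary.AllPairs as AllPairs using ([]; _∷_)
open import Data.List.Relation.Unary.Any as Any using (here; there; index)
open import Data.List.Relation.Unary.Any.Properties using (lookup-index)
open import Data.List.Relation.Unary.Linked as Linked using (Linked; []; [-]; _∷_)
import Data.List.Relation.Unary.Linked.Properties as Linked
open import Data.List.Relation.Unary.Unique.Propositional using (Unique)
import Data.List.Relation.Unary.Unique.Propositional.Properties as Unique
open import Data.List.Relation.Unary.Unique.Propositional.Properties using (Unique[x∷xs]⇒x∉xs)
import Data.List.Sort as Sort
open import Data.Maybe using (just)
open import Data.Maybe.Properties using (just-injective)
open import Data.Maybe.Relation.Binary.Connected renaming (Connected to MaybeConnected) using (just)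
open import Data.Nat using (ℕ; zero; suc; _+_; _*_; _∸_; _⊓_; _⊔_; ∣_-_∣; _<_; _≤_; _≤?_; z≤n; s≤s)
open import Data.Nat.ListAction using (sum)
open import Data.Nat.ListAction.Properties using (sum-↭)
open import Data.Nat.Properties hiding (_≟_)
open import Algebra.Properties.CommutativeSemigroup +-commutativeSemigroup
  using (xy∙z≈xz∙y; xy∙z≈x∙zy; interchange)
open import Data.Nat.Tactic.RingSolver using (solve-∀)
open import Data.Product using (Σ; ∃; _×_; _,_; proj₁; proj₂)
open import Data.Sum as Sum using (_⊎_; inj₁; inj₂)
open import Function using (_∘_; _on_; id)
open import Function.Bundles using (_⇔_; mk⇔; Equivalence)
open import Function.Definitions using (Injective; Bijective)
open import Relation.Binary.PropositionalEquality
  using (_≡_; _≢_; ≢-sym; refl; sym; trans; cong; cong₂; subst; subst₂; setoid; module ≡-Reasoning)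
import Relation.Binary.Construct.On as On
open import Relation.Nullary using (¬_; Dec; yes; no; does)

private variable
  A : Set

last-∷ʳ : ∀ (xs : List A) x → last (xs ∷ʳ x) ≡ just x
last-∷ʳ []           x = refl
last-∷ʳ (_ ∷ [])     x = refl
last-∷ʳ (_ ∷ y ∷ ys) x = last-∷ʳ (y ∷ ys) x

last-++-∷ : ∀ (xs : List A) y ys → last (xs ++ y ∷ ys) ≡ last (y ∷ ys)
last-++-∷ []           y ys = refl
last-++-∷ (_ ∷ [])     y ys = refl
last-++-∷ (_ ∷ x ∷ xs) y ys = last-++-∷ (x ∷ xs) y ys

last-++ : ∀ {y : A} xs ys → last ys ≡ just y → last (xs ++ ys) ≡ just y
last-++ xs (z ∷ zs) eq = trans (last-++-∷ xs z zs) eq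

last-++-tail : ∀ {w v : A} xs rest → last xs ≡ just w → last (w ∷ rest) ≡ just v → last (xs ++ rest) ≡ just v
last-++-tail xs []       eq refl rewrite ++-identityʳ xs = eq
last-++-tail xs (r ∷ rs) _  eq   = trans (last-++-∷ xs r rs) eq

last-∷ : ∀ {x y : A} xs → head xs ≡ just y → last (x ∷ xs) ≡ last xs
last-∷ (_ ∷ _) refl = refl

last⇒∈ : ∀ {z : A} xs → last xs ≡ just z → z ∈ xs
last⇒∈ (_ ∷ [])     refl = here refl
last⇒∈ (_ ∷ y ∷ ys) eq   = there (last⇒∈ (y ∷ ys) eq)

last-nonempty : ∀ (x : A) xs → ∃ λ z → last (x ∷ xs) ≡ just z
last-nonempty x []       = x , refl
last-nonempty x (y ∷ ys) = last-nonempty y ys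

last-view : ∀ {x : A} xs → last xs ≡ just x → ∃ λ pre → xs ≡ pre ∷ʳ x
last-view (_ ∷ [])     refl = [] , refl
last-view (y ∷ z ∷ zs) eq with pre , eq′ ← last-view (z ∷ zs) eq = y ∷ pre , cong (y ∷_) eq′

head-view : ∀ {x : A} xs → head xs ≡ just x → ∃ λ rest → xs ≡ x ∷ rest
head-view (_ ∷ rest) refl = rest , refl

head-++ : ∀ {x : A} xs ys → head xs ≡ just x → head (xs ++ ys) ≡ just x
head-++ (_ ∷ _) ys refl = refl

head-++-∷ : ∀ (xs : List A) y ys zs → head (xs ++ y ∷ ys) ≡ head (xs ++ y ∷ zs)
head-++-∷ []      y ys zs = refl
head-++-∷ (_ ∷ _) y ys zs = refl

last-reverse : ∀ (xs : List A) → last (reverse xs) ≡ head xs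
last-reverse []       = refl
last-reverse (x ∷ xs) rewrite unfold-reverse x xs = last-∷ʳ (reverse xs) x

head-reverse : ∀ (xs : List A) → head (reverse xs) ≡ last xs
head-reverse xs = trans (sym (last-reverse (reverse xs))) (cong last (reverse-involutive xs))

Unique-∷ : ∀ {x : A} {xs} → x ∉ xs → Unique xs → Unique (x ∷ xs)
Unique-∷ x∉ u = ¬Any⇒All¬ _ x∉ ∷ u

Unique-∷⇒≢ : ∀ {x y : A} {xs} → Unique (x ∷ xs) → y ∈ xs → x ≢ y
Unique-∷⇒≢ (x≢ ∷ _) y∈ = All.lookup x≢ y∈

Unique-++⁻ : ∀ (xs : List A) {ys} → Unique (xs ++ ys) → Unique xs × Unique ys
Unique-++⁻ []       u       = [] , u
Unique-++⁻ (x ∷ xs) (a ∷ u) with u₁ , u₂ ← Unique-++⁻ xs u = ++⁻ˡ xs a ∷ u₁ , u₂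

Unique-resp-↭ : ∀ {xs ys : List A} → xs ↭ ys → Unique xs → Unique ys
Unique-resp-↭ p = Perm.Unique-resp-↭ (setoid _) (↭⇒↭ₛ p)

Unique-reverse : ∀ {xs : List A} → Unique xs → Unique (reverse xs)
Unique-reverse {xs = xs} = Unique-resp-↭ (↭-sym (↭-reverse xs))

module _ {R : A → A → Set} where

  Linked-∷ : ∀ {x y xs} → head xs ≡ just y → R x y → Linked R xs → Linked R (x ∷ xs)
  Linked-∷ {xs = _ ∷ _} refl r l = r ∷ l

  Linked-∷ʳ : ∀ {x y} xs → last xs ≡ just x → R x y → Linked R xs → Linked R (xs ∷ʳ y)
  Linked-∷ʳ xs eq r l = Linked.++⁺ l (subst (λ m → MaybeConnected R m _) (sym eq) (just r)) [-]

  Linked-++⁻ : ∀ xs {ys} → Linked R (xs ++ ys) → Linked R xs × Linked R ys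
  Linked-++⁻ []           l       = [] , l
  Linked-++⁻ (_ ∷ [])     l       = [-] , Linked.tail l
  Linked-++⁻ (_ ∷ y ∷ xs) (r ∷ l) with l₁ , l₂ ← Linked-++⁻ (y ∷ xs) l = r ∷ l₁ , l₂

  Linked-reverse : (∀ {x y} → R x y → R y x) → ∀ {xs} → Linked R xs → Linked R (reverse xs)
  Linked-reverse sym-R []  = []
  Linked-reverse sym-R [-] = [-]
  Linked-reverse sym-R {x ∷ y ∷ ys} (r ∷ l) rewrite unfold-reverse x (y ∷ ys) =
    Linked-∷ʳ (reverse (y ∷ ys)) (last-reverse (y ∷ ys)) (sym-R r) (Linked-reverse sym-R l)

Linked-map-All : ∀ {P : A → Set} {R S : A → A → Set} → (∀ {x y} → P x → P y → R x y → S x y) →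
                 ∀ {xs} → All P xs → Linked R xs → Linked S xs
Linked-map-All f []              []      = []
Linked-map-All f (_ ∷ [])        [-]     = [-]
Linked-map-All f (px ∷ py ∷ pxs) (r ∷ l) = f px py r ∷ Linked-map-All f (py ∷ pxs) l

sum-map-+ : ∀ (f g : A → ℕ) xs → sum (map (λ x → f x + g x) xs) ≡ sum (map f xs) + sum (map g xs)
sum-map-+ f g []       = refl
sum-map-+ f g (x ∷ xs) rewrite sum-map-+ f g xs = interchange (f x) (g x) (sum (map f xs)) (sum (map g xs))

sum-map-mono : ∀ {f g : A → ℕ} → (∀ x → g x ≤ f x) → ∀ xs → sum (map g xs) ≤ sum (map f xs)
sum-map-mono g≤f []       = z≤n
sum-map-mono g≤f (x ∷ xs) = +-mono-≤ (g≤f x) (sum-map-mono g≤f xs)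

sum-map-mono-+ : ∀ {f g : A → ℕ} {y k} → (∀ x → g x ≤ f x) → g y + k ≤ f y →
                 ∀ {xs} → y ∈ xs → sum (map g xs) + k ≤ sum (map f xs)
sum-map-mono-+ {f = f} {g} {k = k} g≤f gap {x ∷ xs} (here refl) = begin
  g x + sum (map g xs) + k  ≡⟨ xy∙z≈xz∙y (g x) (sum (map g xs)) k ⟩
  g x + k + sum (map g xs)  ≤⟨ +-mono-≤ gap (sum-map-mono g≤f xs) ⟩
  f x + sum (map f xs)      ∎
  where open ≤-Reasoning
sum-map-mono-+ {f = f} {g} {k = k} g≤f gap {x ∷ xs} (there y∈) = begin
  g x + sum (map g xs) + k    ≡⟨ +-assoc (g x) _ k ⟩
  g x + (sum (map g xs) + k)  ≤⟨ +-mono-≤ (g≤f x) (sum-map-mono-+ g≤f gap y∈) ⟩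
  f x + sum (map f xs)        ∎
  where open ≤-Reasoning

sumConsecutive : (A → A → ℕ) → List A → ℕ
sumConsecutive f (x ∷ y ∷ ys) = f x y + sumConsecutive f (y ∷ ys)
sumConsecutive f _            = 0

module _ {f g : A → A → ℕ} where

  sumConsecutive-+ : ∀ xs → sumConsecutive (λ x y → f x y + g x y) xs ≡ sumConsecutive f xs + sumConsecutive g xs
  sumConsecutive-+ []           = refl
  sumConsecutive-+ (_ ∷ [])     = refl
  sumConsecutive-+ (x ∷ y ∷ ys) rewrite sumConsecutive-+ (y ∷ ys) =
    interchange (f x y) (g x y) (sumConsecutive f (y ∷ ys)) (sumConsecutive g (y ∷ ys))

  sumConsecutive-cong : ∀ {xs} → Linked (λ x y → f x y ≡ g x y) xs → sumConsecutive f xs ≡ sumConsecutive g xs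
  sumConsecutive-cong []      = refl
  sumConsecutive-cong [-]     = refl
  sumConsecutive-cong (e ∷ l) = cong₂ _+_ e (sumConsecutive-cong l)

sumConsecutive-const : ∀ k (xs : List A) → sumConsecutive (λ _ _ → k) xs ≡ (length xs ∸ 1) * k
sumConsecutive-const k []           = refl
sumConsecutive-const k (_ ∷ [])     = refl
sumConsecutive-const k (x ∷ y ∷ ys) = cong (k +_) (sumConsecutive-const k (y ∷ ys))

sumConsecutive≡0 : ∀ {f : A → A → ℕ} {xs} → sumConsecutive f xs ≡ 0 → Linked (λ x y → f x y ≡ 0) xs
sumConsecutive≡0 {xs = []}         _  = []
sumConsecutive≡0 {xs = _ ∷ []}     _  = [-]
sumConsecutive≡0 {f = f} {xs = x ∷ y ∷ ys} eq =
  m+n≡0⇒m≡0 (f x y) eq ∷ sumConsecutive≡0 (m+n≡0⇒n≡0 (f x y) eq)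

sumConsecutive-ends : ∀ (L : A → ℕ) {xs a b} → head xs ≡ just a → last xs ≡ just b →
  sumConsecutive (λ x y → L x + L y) xs + (L a + L b) ≡ 2 * sum (map L xs)
sumConsecutive-ends L {a ∷ []} refl refl = double (L a)
  where
  double : ∀ x → 0 + (x + x) ≡ 2 * (x + 0)
  double = solve-∀
sumConsecutive-ends L {a ∷ y ∷ ys} {b = b} refl eq = begin
  L a + L y + S + (L a + L b)      ≡⟨ regroup (L a) (L y) S (L b) ⟩
  2 * L a + (S + (L y + L b))      ≡⟨ cong (2 * L a +_) (sumConsecutive-ends L {y ∷ ys} refl eq) ⟩
  2 * L a + 2 * sum (map L (y ∷ ys)) ≡⟨ *-distribˡ-+ 2 (L a) _ ⟨
  2 * sum (map L (a ∷ y ∷ ys))     ∎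
  where
  open ≡-Reasoning
  S = sumConsecutive (λ x y → L x + L y) (y ∷ ys)
  regroup : ∀ a y s b → a + y + s + (a + b) ≡ 2 * a + (s + (y + b))
  regroup = solve-∀

telescope-≤ : ∀ (h : A → ℕ) {c e : A → A → ℕ} {xs a b} →
  Linked (λ x y → h x + c x y ≤ h y + e x y) xs → head xs ≡ just a → last xs ≡ just b →
  h a + sumConsecutive c xs ≤ h b + sumConsecutive e xs
telescope-≤ h [-] refl refl = ≤-refl
telescope-≤ h {c} {e} {a ∷ y ∷ ys} {b = b} (step ∷ l) refl eq = begin
  h a + (c a y + sumConsecutive c (y ∷ ys))  ≡⟨ +-assoc (h a) _ _ ⟨
  h a + c a y + sumConsecutive c (y ∷ ys)    ≤⟨ +-monoˡ-≤ _ step ⟩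
  h y + e a y + sumConsecutive c (y ∷ ys)    ≡⟨ xy∙z≈xz∙y (h y) (e a y) _ ⟩
  h y + sumConsecutive c (y ∷ ys) + e a y    ≤⟨ +-monoˡ-≤ (e a y) (telescope-≤ h {xs = y ∷ ys} l refl eq) ⟩
  h b + sumConsecutive e (y ∷ ys) + e a y    ≡⟨ xy∙z≈x∙zy (h b) _ (e a y) ⟩
  h b + (e a y + sumConsecutive e (y ∷ ys))  ∎
  where open ≤-Reasoning



-- Paths and walks

ContainsEdge-sym : ∀ {n} {G : Graph n} {a b : Fin n} (xs : List (Fin n)) →
                   ContainsEdge G a b xs → ContainsEdge G b a xs
ContainsEdge-sym xs (pre , suf , inj₁ eq) = pre , suf , inj₂ eq
ContainsEdge-sym xs (pre , suf , inj₂ eq) = pre , suf , inj₁ eq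

OppositeBranches-sym : ∀ {n} {G : Graph n} {w w′ u v : Fin n} →
                       OppositeBranches G w w′ u v → OppositeBranches G w′ w u v
OppositeBranches-sym {G = G} (p , e) = p , ContainsEdge-sym {G = G} (Path.verts p) e

module SimpleGraph {n : ℕ} (G : Graph n) (simple : IsSimple G) where

  private
    V : Set
    V = Fin n

  open import Data.List.Membership.DecPropositional (_≟_ {n}) using (_∈?_)

  Adj-sym : ∀ {u v} → Adj G u v → Adj G v u
  Adj-sym {u} {v} = subst T (proj₂ simple u v)

  Adj-irrefl : ∀ {u} → ¬ Adj G u u
  Adj-irrefl {u} = subst T (proj₁ simple u)

  trivialPath : ∀ u → Path G u u
  trivialPath u = record
    { verts = u ∷ [] ; linked = [-] ; distinct = [] ∷ [] ; starts = refl ; ends = refl }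

  edgePath : ∀ {u v} → Adj G u v → Path G u v
  edgePath {u} {v} a = record
    { verts = u ∷ v ∷ [] ; linked = a ∷ [-]
    ; distinct = Unique-∷ (λ { (here refl) → Adj-irrefl a }) ([] ∷ [])
    ; starts = refl ; ends = refl }

  reversePath : ∀ {u v} → Path G u v → Path G v u
  reversePath p = record
    { verts = reverse verts
    ; linked = Linked-reverse Adj-sym linked
    ; distinct = Unique-reverse distinct
    ; starts = trans (head-reverse verts) ends
    ; ends = trans (last-reverse verts) starts }
    where open Path p

  len-reversePath : ∀ {u v} (p : Path G u v) → len G (reversePath p) ≡ len G p
  len-reversePath p = cong (_∸ 1) (length-reverse (Path.verts p))

  consPath : ∀ {u w v} → Adj G u w → (p : Path G w v) → u ∉ Path.verts p → Path G u v
  consPath a p u∉ = record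
    { verts = _ ∷ verts ; linked = Linked-∷ starts a linked ; distinct = Unique-∷ u∉ distinct
    ; starts = refl ; ends = trans (last-∷ verts starts) ends }
    where open Path p

  length-path : ∀ {u v} (p : Path G u v) → length (Path.verts p) ≡ suc (len G p)
  length-path p with Path.verts p | Path.starts p
  ... | _ ∷ _ | _ = refl

  closeCycle : ∀ {u a b} (r : Path G a b) → a ≢ b → u ∉ Path.verts r → Adj G u a → Adj G u b → Cycle G
  closeCycle {u} r a≢b u∉ ua ub = go verts linked distinct starts ends u∉
    where
    open Path r
    go : ∀ rs → Linked (Adj G) rs → Unique rs → head rs ≡ just _ → last rs ≡ just _ → u ∉ rs → Cycle G
    go (_ ∷ [])     _ _ refl refl _  = ⊥-elim (a≢b refl)
    go (a ∷ c ∷ rs) l d refl e   u∉′ =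
      u ∷ a ∷ c ∷ rs , s≤s (s≤s (s≤s z≤n)) , Unique-∷ u∉′ d , u , refl ,
      ua ∷ Linked-∷ʳ (a ∷ c ∷ rs) e (Adj-sym ub) l

  module _ {u v z} (p : Path G u v) (pre post : List V) (split : Path.verts p ≡ pre ++ z ∷ post) where

    private
      linked′ : Linked (Adj G) (pre ++ z ∷ post)
      linked′ = subst (Linked (Adj G)) split (Path.linked p)
      distinct′ : Unique (pre ++ z ∷ post)
      distinct′ = subst Unique split (Path.distinct p)
      reassoc : pre ++ z ∷ post ≡ (pre ∷ʳ z) ++ post
      reassoc = sym (++-assoc pre (z ∷ []) post)

    prefixPath : Path G u z
    prefixPath = record
      { verts = pre ∷ʳ z
      ; linked = proj₁ (Linked-++⁻ (pre ∷ʳ z) (subst (Linked (Adj G)) reassoc linked′))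
      ; distinct = proj₁ (Unique-++⁻ (pre ∷ʳ z) (subst Unique reassoc distinct′))
      ; starts = trans (head-++-∷ pre z [] post) (trans (cong head (sym split)) (Path.starts p))
      ; ends = last-∷ʳ pre z }

    suffixPath : Path G z v
    suffixPath = record
      { verts = z ∷ post
      ; linked = proj₂ (Linked-++⁻ pre linked′)
      ; distinct = proj₂ (Unique-++⁻ pre distinct′)
      ; starts = refl
      ; ends = trans (sym (last-++-∷ pre z post)) (trans (cong last (sym split)) (Path.ends p)) }

    len-prefixPath : len G prefixPath ≡ length pre
    len-prefixPath rewrite length-++ pre {z ∷ []} = m+n∸n≡m (length pre) 1

    len-path-split : len G p ≡ length pre + length post
    len-path-split rewrite split | length-++ pre {z ∷ post} = cong (_∸ 1) (+-suc (length pre) (length post))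

  Step : V → V → Set
  Step u v = Adj G u v ⊎ u ≡ v

  record Walk (u v : V) : Set where
    field
      verts  : List V
      linked : Linked Step verts
      starts : head verts ≡ just u
      ends   : last verts ≡ just v

  Shortcut : V → V → List V → Set
  Shortcut u v ws =
    Σ (Path G u v) λ p → Path.verts p ⊆ ws × (Path.verts p ≡ ws ⊎ length (Path.verts p) < length ws)

  private
    ≡⊎<⇒≤ : ∀ {xs ys : List V} → xs ≡ ys ⊎ length xs < length ys → length xs ≤ length ys
    ≡⊎<⇒≤ (inj₁ refl) = ≤-refl
    ≡⊎<⇒≤ (inj₂ lt) = <⇒≤ lt

    length-< : ∀ pre {u post} → length {A = V} (u ∷ post) ≤ length (pre ++ u ∷ post)
    length-< pre {u} {post} rewrite length-++ pre {u ∷ post} = m≤n+m (suc (length post)) (length pre)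

    shortcut : ∀ {k} u ws {v} → length ws < k → Linked Step (u ∷ ws) → last (u ∷ ws) ≡ just v →
               Shortcut u v (u ∷ ws)
    shortcut {suc k} u ws {v} lt l e with u ∈? ws
    shortcut {suc k} u ws {v} lt l e | yes u∈ with pre , post , refl ← ∈-∃++ u∈ =
      skip (shortcut u post (≤-trans (length-< pre) (≤-pred lt)) (proj₂ (Linked-++⁻ (u ∷ pre) l))
                     (trans (sym (last-++-∷ (u ∷ pre) u post)) e))
      where
      skip : Shortcut u v (u ∷ post) → Shortcut u v (u ∷ pre ++ u ∷ post)
      skip (p , sub , size) = p , sub′ , inj₂ (s≤s (≤-trans (≡⊎<⇒≤ size) (length-< pre)))
        where
        sub′ : Path.verts p ⊆ u ∷ pre ++ u ∷ post
        sub′ q with sub q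
        ... | here eq = here eq
        ... | there q′ = there (∈-++⁺ʳ pre (there q′))
    shortcut {suc k} u [] lt l refl | no _ = trivialPath u , (λ q → q) , inj₁ refl
    shortcut {suc k} u (w ∷ ws) (s≤s lt) (st ∷ l) e | no u∉
      with p , sub , size ← shortcut w ws lt l e =
      consPath (adj st) p (λ q → u∉ (sub q)) , sub′ , size′ size
      where
      adj : Step u w → Adj G u w
      adj (inj₁ a) = a
      adj (inj₂ refl) = ⊥-elim (u∉ (here refl))
      sub′ : u ∷ Path.verts p ⊆ u ∷ w ∷ ws
      sub′ (here eq) = here eq
      sub′ (there q) = there (sub q)
      size′ : Path.verts p ≡ w ∷ ws ⊎ length (Path.verts p) < length (w ∷ ws) →
              u ∷ Path.verts p ≡ u ∷ w ∷ ws ⊎ length (u ∷ Path.verts p) < length (u ∷ w ∷ ws)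
      size′ (inj₁ eq) = inj₁ (cong (u ∷_) eq)
      size′ (inj₂ lt) = inj₂ (s≤s lt)

  walkToPath : ∀ {u v} (w : Walk u v) → Shortcut u v (Walk.verts w)
  walkToPath record { verts = x ∷ xs ; linked = l ; starts = refl ; ends = e } = shortcut x xs ≤-refl l e

  joinWalk : ∀ {u w v} → Path G u w → Path G w v → Walk u v
  joinWalk {u} {w} {v} p q = record
    { verts = Path.verts p ++ rest
    ; linked = Linked.++⁺ (Linked.map inj₁ (Path.linked p)) junction (Linked.tail linked-q)
    ; starts = head-++ (Path.verts p) rest (Path.starts p)
    ; ends = last-++-tail (Path.verts p) rest (Path.ends p) (subst (λ xs → last xs ≡ just v) q-view (Path.ends q)) }
    where
    rest : List V
    rest = proj₁ (head-view (Path.verts q) (Path.starts q))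
    q-view : Path.verts q ≡ w ∷ rest
    q-view = proj₂ (head-view (Path.verts q) (Path.starts q))
    linked-q : Linked Step (w ∷ rest)
    linked-q = Linked.map inj₁ (subst (Linked (Adj G)) q-view (Path.linked q))
    junction : MaybeConnected Step (last (Path.verts p)) (head rest)
    junction = subst (λ m → MaybeConnected Step m (head rest)) (sym (Path.ends p)) (Linked.head′ linked-q)

  length-joinWalk : ∀ {u w v} (p : Path G u w) (q : Path G w v) →
                    length (Walk.verts (joinWalk p q)) ≡ suc (len G p + len G q)
  length-joinWalk p q with head-view (Path.verts q) (Path.starts q)
  ... | rest , q-view = begin
    length (Path.verts p ++ rest)        ≡⟨ length-++ (Path.verts p) ⟩
    length (Path.verts p) + length rest  ≡⟨ cong₂ _+_ (length-path p) (cong (λ xs → length xs ∸ 1) (sym q-view)) ⟩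
    suc (len G p + len G q)              ∎
    where open ≡-Reasoning

  ∈-joinWalk : ∀ {u w v} (p : Path G u w) (q : Path G w v) → w ∈ Walk.verts (joinWalk p q)
  ∈-joinWalk p q = ∈-++⁺ˡ (last⇒∈ (Path.verts p) (Path.ends p))

  ∈-joinWalk⁻ : ∀ {u w v x} (p : Path G u w) (q : Path G w v) → x ∈ Walk.verts (joinWalk p q) →
                x ∈ Path.verts p ⊎ x ∈ Path.verts q
  ∈-joinWalk⁻ p q x∈ with head-view (Path.verts q) (Path.starts q)
  ... | rest , q-view with ∈-++⁻ (Path.verts p) x∈
  ...   | inj₁ x∈p = inj₁ x∈p
  ...   | inj₂ x∈rest = inj₂ (subst (_ ∈_) (sym q-view) (there x∈rest))

  edgeWalk : ∀ {u a b v} → Path G u a → Adj G a b → Path G b v → Walk u v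
  edgeWalk p ab q = record
    { verts = Path.verts p ++ Path.verts q
    ; linked = Linked.++⁺ (Linked.map inj₁ (Path.linked p)) junction (Linked.map inj₁ (Path.linked q))
    ; starts = head-++ (Path.verts p) (Path.verts q) (Path.starts p)
    ; ends = last-++ (Path.verts p) (Path.verts q) (Path.ends q) }
    where
    junction : MaybeConnected Step (last (Path.verts p)) (head (Path.verts q))
    junction = subst₂ (MaybeConnected Step) (sym (Path.ends p)) (sym (Path.starts q)) (just (inj₁ ab))

  length-edgeWalk : ∀ {u a b v} (p : Path G u a) (ab : Adj G a b) (q : Path G b v) →
                    length (Walk.verts (edgeWalk p ab q)) ≡ suc (len G p + suc (len G q))
  length-edgeWalk p ab q = trans (length-++ (Path.verts p)) (cong₂ _+_ (length-path p) (length-path q))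

  edgeWalk-contains : ∀ {u a b v} (p : Path G u a) (ab : Adj G a b) (q : Path G b v) →
                      ContainsEdge G a b (Walk.verts (edgeWalk p ab q))
  edgeWalk-contains {a = a} {b} p ab q
    with pre , p-view ← last-view (Path.verts p) (Path.ends p)
       | suf , q-view ← head-view (Path.verts q) (Path.starts q) =
    pre , suf , inj₁ (begin
      Path.verts p ++ Path.verts q  ≡⟨ cong₂ _++_ p-view q-view ⟩
      (pre ∷ʳ a) ++ b ∷ suf         ≡⟨ ++-assoc pre (a ∷ []) (b ∷ suf) ⟩
      pre ++ a ∷ b ∷ suf            ∎)
    where open ≡-Reasoning

  module Distance (d : V → V → ℕ) (isd : IsDistance G d) where

    shortest : ∀ u v → Path G u v
    shortest u v = proj₁ (proj₁ (isd u v))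

    len-shortest : ∀ u v → len G (shortest u v) ≡ d u v
    len-shortest u v = proj₂ (proj₁ (isd u v))

    d≤len : ∀ {u v} (p : Path G u v) → d u v ≤ len G p
    d≤len {u} {v} = proj₂ (isd u v)

    d<length-walk : ∀ {u v} (w : Walk u v) → suc (d u v) ≤ length (Walk.verts w)
    d<length-walk w with p , _ , size ← walkToPath w =
      ≤-trans (s≤s (d≤len p)) (≤-trans (≤-reflexive (sym (length-path p))) (≡⊎<⇒≤ size))

    tightWalk⇒path : ∀ {u v} (w : Walk u v) → length (Walk.verts w) ≡ suc (d u v) →
                     Σ (Path G u v) λ p → Path.verts p ≡ Walk.verts w
    tightWalk⇒path w tight with walkToPath w
    ... | p , _ , inj₁ same    = p , same
    ... | p , _ , inj₂ shorter = ⊥-elim (<⇒≱ shorter (begin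
          length (Walk.verts w)  ≡⟨ tight ⟩
          suc (d _ _)            ≤⟨ s≤s (d≤len p) ⟩
          suc (len G p)          ≡⟨ length-path p ⟨
          length (Path.verts p)  ∎))
      where open ≤-Reasoning

    private
      len-shortest-+ : ∀ u w v → len G (shortest u w) + len G (shortest w v) ≡ d u w + d w v
      len-shortest-+ u w v = cong₂ _+_ (len-shortest u w) (len-shortest w v)

    d-triangle : ∀ u w v → d u v ≤ d u w + d w v
    d-triangle u w v = ≤-pred (begin
      suc (d u v)                                        ≤⟨ d<length-walk (joinWalk p q) ⟩
      length (Walk.verts (joinWalk p q))                 ≡⟨ length-joinWalk p q ⟩
      suc (len G p + len G q)                            ≡⟨ cong suc (len-shortest-+ u w v) ⟩
      suc (d u w + d w v)                                ∎)
      where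
      open ≤-Reasoning
      p = shortest u w
      q = shortest w v

    path-through : ∀ {u w v} → d u w + d w v ≡ d u v → Σ (Path G u v) λ r → w ∈ Path.verts r
    path-through {u} {w} {v} eq = proj₁ tight , subst (w ∈_) (sym (proj₂ tight)) (∈-joinWalk p q)
      where
      p = shortest u w
      q = shortest w v
      tight = tightWalk⇒path (joinWalk p q)
                (trans (length-joinWalk p q) (cong suc (trans (len-shortest-+ u w v) eq)))

    path-through-edge : ∀ {u a b v} → Adj G a b → d u a + suc (d b v) ≡ d u v →
                        Σ (Path G u v) λ r → ContainsEdge G a b (Path.verts r)
    path-through-edge {u} {a} {b} {v} ab eq =
      proj₁ tight , subst (ContainsEdge G a b) (sym (proj₂ tight)) (edgeWalk-contains p ab q)
      where
      p = shortest u a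
      q = shortest b v
      tight = tightWalk⇒path (edgeWalk p ab q)
                (trans (length-edgeWalk p ab q)
                       (cong suc (trans (cong₂ (λ x y → x + suc y) (len-shortest u a) (len-shortest b v)) eq)))

-- Trees: distances, weight centres and branches

module Tree {n : ℕ} (T : Graph n) (tree : IsTree T) where

  open SimpleGraph T (proj₁ tree) public

  private
    V : Set
    V = Fin n

    open import Data.List.Membership.DecPropositional (_≟_ {n}) using (_∈?_)

    acyclic : ¬ Cycle T
    acyclic = proj₂ (proj₂ tree)

    -- Two paths from u that leave u through different neighbours a ≠ b would, joined at their common
    -- end and shortcut, give an a–b path avoiding u, which closes a cycle through u.
    same-tail : ∀ u (ps qs : List V) → Linked (Adj T) (u ∷ ps) → Unique (u ∷ ps) →
                Linked (Adj T) (u ∷ qs) → Unique (u ∷ qs) → last (u ∷ ps) ≡ last (u ∷ qs) → ps ≡ qs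
    same-tail u []       []       _  _  _  _  _  = refl
    same-tail u []       (b ∷ qs) _  _  _  uq eq = ⊥-elim (Unique[x∷xs]⇒x∉xs uq (last⇒∈ (b ∷ qs) (sym eq)))
    same-tail u (a ∷ ps) []       _  up _  _  eq = ⊥-elim (Unique[x∷xs]⇒x∉xs up (last⇒∈ (a ∷ ps) eq))
    same-tail u (a ∷ ps) (b ∷ qs) lp up lq uq eq with a ≟ b
    ... | yes refl =
      cong (a ∷_) (same-tail a ps qs (Linked.tail lp) (AllPairs.tail up) (Linked.tail lq) (AllPairs.tail uq) eq)
    ... | no a≢b = ⊥-elim (acyclic (closeCycle r a≢b u∉r (Linked.head lp) (Linked.head lq)))
      where
      z : V
      z = proj₁ (last-nonempty a ps)
      p : Path T a z
      p = record { verts = a ∷ ps ; linked = Linked.tail lp ; distinct = AllPairs.tail up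
                 ; starts = refl ; ends = proj₂ (last-nonempty a ps) }
      q : Path T b z
      q = record { verts = b ∷ qs ; linked = Linked.tail lq ; distinct = AllPairs.tail uq
                 ; starts = refl ; ends = trans (sym eq) (proj₂ (last-nonempty a ps)) }
      shortcut : Shortcut a b (Walk.verts (joinWalk p (reversePath q)))
      shortcut = walkToPath (joinWalk p (reversePath q))
      r : Path T a b
      r = proj₁ shortcut
      u∉r : u ∉ Path.verts r
      u∉r u∈r with ∈-joinWalk⁻ p (reversePath q) (proj₁ (proj₂ shortcut) u∈r)
      ... | inj₁ u∈p = Unique[x∷xs]⇒x∉xs up u∈p
      ... | inj₂ u∈q = Unique[x∷xs]⇒x∉xs uq (∈-resp-↭ (↭-reverse (b ∷ qs)) u∈q)

  path-unique : ∀ {u v} (p q : Path T u v) → Path.verts p ≡ Path.verts q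
  path-unique record { verts = u ∷ ps ; linked = lp ; distinct = up ; starts = refl ; ends = ep }
              record { verts = .u ∷ qs ; linked = lq ; distinct = uq ; starts = refl ; ends = eq } =
    cong (u ∷_) (same-tail u ps qs lp up lq uq (trans ep (sym eq)))

  module Metric (d : V → V → ℕ) (isd : IsDistance T d) where

    open Distance d isd public

    len≡d : ∀ {u v} (p : Path T u v) → len T p ≡ d u v
    len≡d {u} {v} p = trans (cong (λ xs → length xs ∸ 1) (path-unique p (shortest u v))) (len-shortest u v)

    detour≡d : ∀ {D} → IsDetour T D → ∀ u v → D u v ≡ d u v
    detour≡d isD u v = trans (sym (proj₂ (proj₁ (isD u v)))) (len≡d (proj₁ (proj₁ (isD u v))))

    d-refl : ∀ u → d u u ≡ 0
    d-refl u = sym (len≡d (trivialPath u))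

    d-edge : ∀ {u v} → Adj T u v → d u v ≡ 1
    d-edge a = sym (len≡d (edgePath a))

    d-sym : ∀ u v → d u v ≡ d v u
    d-sym u v = trans (sym (len≡d p)) (trans (sym (len-reversePath p)) (len≡d (reversePath p)))
      where p = shortest u v

    d≡0⇒≡ : ∀ {u v} → d u v ≡ 0 → u ≡ v
    d≡0⇒≡ {u} {v} eq = single (Path.verts p) (Path.starts p) (Path.ends p) (trans (len≡d p) eq)
      where
      p = shortest u v
      single : ∀ xs → head xs ≡ just u → last xs ≡ just v → length xs ∸ 1 ≡ 0 → u ≡ v
      single (_ ∷ []) refl refl _ = refl

    d-split : ∀ {u v z} (p : Path T u v) → z ∈ Path.verts p → d u v ≡ d u z + d z v
    d-split {u} {v} {z} p z∈ with pre , post , split ← ∈-∃++ z∈ = begin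
      d u v                     ≡⟨ len≡d p ⟨
      len T p                   ≡⟨ len-path-split p pre post split ⟩
      length pre + length post  ≡⟨ cong₂ _+_ (trans (sym (len-prefixPath p pre post split)) (len≡d to-z))
                                             (len≡d (suffixPath p pre post split)) ⟩
      d u z + d z v             ∎
      where
      open ≡-Reasoning
      to-z : Path T u z
      to-z = prefixPath p pre post split

    d-split-edge : ∀ {u v a b} (p : Path T u v) pre suf → Path.verts p ≡ pre ++ a ∷ b ∷ suf →
                   d u v ≡ d u a + suc (d b v)
    d-split-edge {u} {v} {a} {b} p pre suf split = begin
      d u v                    ≡⟨ d-split p (subst (a ∈_) (sym split) (∈-++⁺ʳ pre (here refl))) ⟩
      d u a + d a v            ≡⟨ cong (d u a +_) (d-split from-a (there (here refl))) ⟩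
      d u a + (d a b + d b v)  ≡⟨ cong (λ x → d u a + (x + d b v)) (d-edge (Linked.head (Path.linked from-a))) ⟩
      d u a + suc (d b v)      ∎
      where
      open ≡-Reasoning
      from-a : Path T a v
      from-a = suffixPath p pre (b ∷ suf) split

    private
      off-path-neighbour-unique : ∀ {u x y z} → Adj T x y → Adj T z y →
        y ∉ Path.verts (shortest u x) → y ∉ Path.verts (shortest u z) → x ≡ z
      off-path-neighbour-unique {u} {x} {y} {z} xy zy y∉ux y∉uz = just-injective (begin
        just x                                      ≡⟨ Path.ends (shortest u x) ⟨
        last (Path.verts (shortest u x))            ≡⟨ head-reverse (Path.verts (shortest u x)) ⟨
        head (reverse (Path.verts (shortest u x)))  ≡⟨ cong head (∷-injectiveʳ same-path) ⟩
        head (reverse (Path.verts (shortest u z)))  ≡⟨ head-reverse (Path.verts (shortest u z)) ⟩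
        last (Path.verts (shortest u z))            ≡⟨ Path.ends (shortest u z) ⟩
        just z                                      ∎)
        where
        open ≡-Reasoning
        back : ∀ {c} → Adj T c y → y ∉ Path.verts (shortest u c) → Path T y u
        back {c} cy y∉ = consPath (Adj-sym cy) (reversePath (shortest u c)) (y∉ ∘ ∈-resp-↭ (↭-reverse _))
        same-path : Path.verts (back xy y∉ux) ≡ Path.verts (back zy y∉uz)
        same-path = path-unique (back xy y∉ux) (back zy y∉uz)

      convex-through : ∀ {u a y c} → Adj T a y → Adj T y c → y ∈ Path.verts (shortest u a) →
                       d u y + d u y ≤ d u a + d u c
      convex-through {u} {a} {y} {c} ay yc y∈ = begin
        d u y + d u y            ≤⟨ +-monoʳ-≤ (d u y) (d-triangle u c y) ⟩
        d u y + (d u c + d c y)  ≡⟨ cong (λ t → d u y + (d u c + t)) (d-edge (Adj-sym yc)) ⟩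
        d u y + (d u c + 1)      ≡⟨ cong (d u y +_) (+-comm (d u c) 1) ⟩
        d u y + (1 + d u c)      ≡⟨ +-assoc (d u y) 1 (d u c) ⟨
        (d u y + 1) + d u c      ≡⟨ cong (λ t → d u y + t + d u c) (d-edge (Adj-sym ay)) ⟨
        (d u y + d y a) + d u c  ≡⟨ cong (_+ d u c) (d-split (shortest u a) y∈) ⟨
        d u a + d u c            ∎
        where open ≤-Reasoning

    d-convex : ∀ {x y z} → Adj T x y → Adj T y z → x ≢ z → ∀ u → d u y + d u y ≤ d u x + d u z
    d-convex {x} {y} {z} xy yz x≢z u with y ∈? Path.verts (shortest u x) | y ∈? Path.verts (shortest u z)
    ... | yes y∈ux | _        = convex-through xy yz y∈ux
    ... | no _     | yes y∈uz =
      subst (d u y + d u y ≤_) (+-comm (d u z) (d u x)) (convex-through (Adj-sym yz) (Adj-sym xy) y∈uz)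
    ... | no y∉ux  | no y∉uz  = ⊥-elim (x≢z (off-path-neighbour-unique xy (Adj-sym yz) y∉ux y∉uz))

    W : V → ℕ
    W = weight T d

    W-convex : ∀ {x y z} → Adj T x y → Adj T y z → x ≢ z → W y + W y + 2 ≤ W x + W z
    W-convex {x} {y} {z} xy yz x≢z =
      subst₂ (λ a b → a + 2 ≤ b) (sum-map-+ (λ u → d u y) (λ u → d u y) (allFin n))
                                 (sum-map-+ (λ u → d u x) (λ u → d u z) (allFin n))
        (sum-map-mono-+ (d-convex xy yz x≢z) at-y (∈-allFin y))
      where
      at-y : d y y + d y y + 2 ≤ d y x + d y z
      at-y rewrite d-refl y | d-edge (Adj-sym xy) | d-edge yz = ≤-refl

    W-increasing : ∀ {a b cs} → Linked (Adj T) (a ∷ b ∷ cs) → Unique (a ∷ b ∷ cs) → W a ≤ W b →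
                   ∀ {t} → t ∈ cs → W b < W t
    W-increasing {a} {b} {c ∷ cs} (ab ∷ bc ∷ l) distinct Wa≤Wb t∈ = step t∈
      where
      a≢c : a ≢ c
      a≢c a≡c = Unique[x∷xs]⇒x∉xs distinct (there (here a≡c))
      Wb<Wc : W b < W c
      Wb<Wc = +-cancelˡ-≤ (W b) (suc (W b)) (W c) (begin
        W b + suc (W b)    ≡⟨ +-suc (W b) (W b) ⟩
        suc (W b + W b)    ≤⟨ n≤1+n _ ⟩
        2 + (W b + W b)    ≡⟨ +-comm 2 (W b + W b) ⟩
        W b + W b + 2      ≤⟨ W-convex ab bc a≢c ⟩
        W a + W c          ≤⟨ +-monoˡ-≤ (W c) Wa≤Wb ⟩
        W b + W c          ∎)
        where open ≤-Reasoning
      step : ∀ {t} → t ∈ c ∷ cs → W b < W t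
      step (here refl) = Wb<Wc
      step (there t∈cs) = <-trans Wb<Wc (W-increasing (bc ∷ l) (AllPairs.tail distinct) (<⇒≤ Wb<Wc) t∈cs)

    IsCentre : V → Set
    IsCentre = IsWeightCenter T d

    private
      isCentre? : ∀ v → Dec (IsCentre v)
      isCentre? v = all? (λ u → W v ≤? W u)

    centre-exists : V → Σ V IsCentre
    centre-exists v = argmin W v (allFin n) , λ u → All.lookup (f[argmin]≤f[xs] v (allFin n)) (∈-allFin u)

    ∈-centers⁺ : ∀ {v} → IsCentre v → v ∈ centers T d
    ∈-centers⁺ {v} c = ∈-filter⁺ isCentre? (∈-allFin v) c

    ∈-centers⁻ : ∀ {v} → v ∈ centers T d → IsCentre v
    ∈-centers⁻ v∈ = proj₂ (∈-filter⁻ isCentre? {xs = allFin n} v∈)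

    centers-unique : Unique (centers T d)
    centers-unique = Unique.filter⁺ isCentre? (Unique.allFin⁺ n)

    centres-adjacent : ∀ {w₁ w₂} → IsCentre w₁ → IsCentre w₂ → w₁ ≢ w₂ → Adj T w₁ w₂
    centres-adjacent {w₁} {w₂} c₁ c₂ w₁≢w₂ = go verts linked distinct starts ends
      where
      open Path (shortest w₁ w₂)
      go : ∀ xs → Linked (Adj T) xs → Unique xs → head xs ≡ just w₁ → last xs ≡ just w₂ → Adj T w₁ w₂
      go (_ ∷ [])         _          _ refl refl = ⊥-elim (w₁≢w₂ refl)
      go (_ ∷ _ ∷ [])     (a ∷ _)    _ refl refl = a
      go (_ ∷ b ∷ c ∷ cs) l          u refl e    =
        ⊥-elim (<⇒≱ (W-increasing l u (c₁ b) (last⇒∈ (c ∷ cs) e)) (c₂ b))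

    data Centres : Set where
      one : ∀ w → centers T d ≡ w ∷ [] → Centres
      two : ∀ w w′ → centers T d ≡ w ∷ w′ ∷ [] → Adj T w w′ → Centres

    private
      centre-triangle : ∀ {a b c} → IsCentre a → IsCentre b → IsCentre c → Unique (a ∷ b ∷ c ∷ []) → Cycle T
      centre-triangle ca cb cc u@((a≢b ∷ a≢c ∷ []) ∷ (b≢c ∷ []) ∷ [] ∷ []) =
        _ , ≤-refl , u , _ , refl ,
        centres-adjacent ca cb a≢b ∷ centres-adjacent cb cc b≢c ∷ centres-adjacent cc ca (a≢c ∘ sym) ∷ [-]

    centres : V → Centres
    centres v = classify (centers T d) refl (∈-centers⁺ (proj₂ (centre-exists v)))
      where
      centre : ∀ {cs z} → centers T d ≡ cs → z ∈ cs → IsCentre z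
      centre eq z∈ = ∈-centers⁻ (subst (_ ∈_) (sym eq) z∈)
      classify : ∀ cs → centers T d ≡ cs → proj₁ (centre-exists v) ∈ cs → Centres
      classify [] _ ()
      classify cs eq _ with subst Unique eq centers-unique
      classify (w ∷ [])           eq _ | _ = one w eq
      classify (w ∷ w′ ∷ [])      eq _ | (w≢w′ ∷ []) ∷ _ =
        two w w′ eq (centres-adjacent (centre eq (here refl)) (centre eq (there (here refl))) w≢w′)
      classify (w₁ ∷ w₂ ∷ w₃ ∷ _) eq _ | u =
        ⊥-elim (acyclic (centre-triangle (centre eq (here refl)) (centre eq (there (here refl)))
                                         (centre eq (there (there (here refl)))) (Unique.take⁺ 3 u)))

    module NearestCentre (D : V → V → ℕ) (isD : IsDetour T D) (d≤n : ∀ u v → d u v ≤ n) where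

      L : V → ℕ
      L = 𝓛 T d D

      Tight : V → V → Set
      Tight u v = D u v ≡ L u + L v + ζ T d

      L-one : ∀ {w} → centers T d ≡ w ∷ [] → ∀ u → L u ≡ d u w
      L-one {w} eq u = begin
        L u            ≡⟨ cong (foldr (λ x m → D u x ⊓ m) n) eq ⟩
        D u w ⊓ n      ≡⟨ cong (_⊓ n) (detour≡d isD u w) ⟩
        d u w ⊓ n      ≡⟨ m≤n⇒m⊓n≡m (d≤n u w) ⟩
        d u w          ∎
        where open ≡-Reasoning

      L-two : ∀ {w w′} → centers T d ≡ w ∷ w′ ∷ [] → ∀ u → L u ≡ d u w ⊓ d u w′
      L-two {w} {w′} eq u = begin
        L u                     ≡⟨ cong (foldr (λ x m → D u x ⊓ m) n) eq ⟩
        D u w ⊓ (D u w′ ⊓ n)    ≡⟨ cong₂ (λ x y → x ⊓ (y ⊓ n)) (detour≡d isD u w) (detour≡d isD u w′) ⟩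
        d u w ⊓ (d u w′ ⊓ n)    ≡⟨ cong (d u w ⊓_) (m≤n⇒m⊓n≡m (d≤n u w′)) ⟩
        d u w ⊓ d u w′          ∎
        where open ≡-Reasoning

      ζ-one : ∀ {w} → centers T d ≡ w ∷ [] → ζ T d ≡ 0
      ζ-one eq = cong (λ cs → length cs ∸ 1) eq

      ζ-two : ∀ {w w′} → centers T d ≡ w ∷ w′ ∷ [] → ζ T d ≡ 1
      ζ-two eq = cong (λ cs → length cs ∸ 1) eq

      private
        nearest : ∀ {w w′} → centers T d ≡ w ∷ w′ ∷ [] → ∀ u → L u ≡ d u w ⊎ L u ≡ d u w′
        nearest {w} {w′} eq u = Sum.map (trans (L-two eq u)) (trans (L-two eq u)) (⊓-sel (d u w) (d u w′))

        via : ∀ {u v k} a b → d a b ≤ k → L u ≡ d u a → L v ≡ d v b → d u v ≤ L u + L v + k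
        via {u} {v} {k} a b ab≤k La Lb = begin
          d u v                    ≤⟨ d-triangle u a v ⟩
          d u a + d a v            ≤⟨ +-monoʳ-≤ (d u a) (d-triangle a b v) ⟩
          d u a + (d a b + d b v)  ≡⟨ +-assoc (d u a) (d a b) (d b v) ⟨
          d u a + d a b + d b v    ≡⟨ cong₂ (λ x y → x + d a b + y) (sym La) (trans (d-sym b v) (sym Lb)) ⟩
          L u + d a b + L v        ≤⟨ +-monoˡ-≤ (L v) (+-monoʳ-≤ (L u) ab≤k) ⟩
          L u + k + L v            ≡⟨ xy∙z≈xz∙y (L u) k (L v) ⟩
          L u + L v + k            ∎
          where open ≤-Reasoning

      D-bound : ∀ u v → D u v ≤ L u + L v + ζ T d
      D-bound u v rewrite detour≡d isD u v with centres u
      ... | one w eq rewrite ζ-one eq = via w w (≤-reflexive (d-refl w)) (L-one eq u) (L-one eq v)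
      ... | two w w′ eq ww′ rewrite ζ-two eq with nearest eq u | nearest eq v
      ...   | inj₁ Lu | inj₁ Lv = via w  w  (≤-trans (≤-reflexive (d-refl w)) z≤n) Lu Lv
      ...   | inj₁ Lu | inj₂ Lv = via w  w′ (≤-reflexive (d-edge ww′)) Lu Lv
      ...   | inj₂ Lu | inj₁ Lv = via w′ w  (≤-reflexive (d-edge (Adj-sym ww′))) Lu Lv
      ...   | inj₂ Lu | inj₂ Lv = via w′ w′ (≤-trans (≤-reflexive (d-refl w′)) z≤n) Lu Lv

      tight⇔different-branches : ∀ {w u v} → centers T d ≡ w ∷ [] → u ≢ v →
                                 Tight u v ⇔ DifferentBranches T w u v
      tight⇔different-branches {w} {u} {v} eq u≢v = mk⇔
        (λ tight → u≢v , path-through (sym (trans (sym (detour≡d isD u v)) (trans tight radii))))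
        (λ { (_ , p , w∈p) → trans (detour≡d isD u v) (trans (d-split p w∈p) (sym radii)) })
        where
        radii : L u + L v + ζ T d ≡ d u w + d w v
        radii rewrite L-one eq u | L-one eq v | ζ-one eq = trans (+-identityʳ _) (cong (d u w +_) (d-sym v w))

      private
        one-apart : ∀ {u v a b} → L u ≤ d u a → L v ≤ d v b → d u v ≡ d u a + suc (d b v) →
                    L u + L v + 1 ≤ d u v
        one-apart {u} {v} {a} {b} La Lb eq = begin
          L u + L v + 1        ≤⟨ +-monoˡ-≤ 1 (+-mono-≤ La (≤-trans Lb (≤-reflexive (d-sym v b)))) ⟩
          d u a + d b v + 1    ≡⟨ trans (+-comm _ 1) (sym (+-suc (d u a) (d b v))) ⟩
          d u a + suc (d b v)  ≡⟨ eq ⟨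
          d u v                ∎
          where open ≤-Reasoning

      tight⇔opposite-branches : ∀ {w w′ u v} → centers T d ≡ w ∷ w′ ∷ [] → Adj T w w′ →
                                Tight u v ⇔ OppositeBranches T w w′ u v
      tight⇔opposite-branches {w} {w′} {u} {v} eq ww′ = mk⇔ to from
        where
        tight′ : Tight u v → d u v ≡ L u + L v + 1
        tight′ tight = trans (sym (detour≡d isD u v)) (trans tight (cong (L u + L v +_) (ζ-two eq)))
        same-centre : ∀ {c} → L u ≡ d u c → L v ≡ d v c → ¬ Tight u v
        same-centre {c} Lu Lv tight
          with () ← +-cancelˡ-≤ (L u + L v) 1 0
                      (subst (_≤ L u + L v + 0) (tight′ tight) (via c c (≤-reflexive (d-refl c)) Lu Lv))
        apart : ∀ {a b} → L u ≡ d u a → L v ≡ d v b → Tight u v → d u a + suc (d b v) ≡ d u v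
        apart {a} {b} Lu Lv tight = sym (begin
          d u v                ≡⟨ tight′ tight ⟩
          L u + L v + 1        ≡⟨ cong₂ (λ x y → x + y + 1) Lu (trans Lv (d-sym v b)) ⟩
          d u a + d b v + 1    ≡⟨ trans (+-comm _ 1) (sym (+-suc (d u a) (d b v))) ⟩
          d u a + suc (d b v)  ∎)
          where open ≡-Reasoning
        to : Tight u v → OppositeBranches T w w′ u v
        to tight with nearest eq u | nearest eq v
        ... | inj₁ Lu | inj₁ Lv = ⊥-elim (same-centre Lu Lv tight)
        ... | inj₁ Lu | inj₂ Lv = path-through-edge ww′ (apart Lu Lv tight)
        ... | inj₂ Lu | inj₁ Lv = OppositeBranches-sym {G = T} (path-through-edge (Adj-sym ww′) (apart Lu Lv tight))
        ... | inj₂ Lu | inj₂ Lv = ⊥-elim (same-centre Lu Lv tight)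
        tight-from : ∀ {a b} → L u ≤ d u a → L v ≤ d v b → d u v ≡ d u a + suc (d b v) → Tight u v
        tight-from La Lb split = ≤-antisym (D-bound u v)
          (subst₂ _≤_ (cong (L u + L v +_) (sym (ζ-two eq))) (sym (detour≡d isD u v)) (one-apart La Lb split))
        L≤w : ∀ x → L x ≤ d x w
        L≤w x = ≤-trans (≤-reflexive (L-two eq x)) (m⊓n≤m (d x w) (d x w′))
        L≤w′ : ∀ x → L x ≤ d x w′
        L≤w′ x = ≤-trans (≤-reflexive (L-two eq x)) (m⊓n≤n (d x w) (d x w′))
        from : OppositeBranches T w w′ u v → Tight u v
        from (p , pre , suf , inj₁ split) = tight-from (L≤w u) (L≤w′ v) (d-split-edge p pre suf split)
        from (p , pre , suf , inj₂ split) = tight-from (L≤w′ u) (L≤w v) (d-split-edge p pre suf split)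

      ζ′≤L+L : ∀ {u v} → u ≢ v → ζ' T d ≤ L u + L v
      ζ′≤L+L {u} {v} u≢v with centres u
      ... | two _ _ eq _ rewrite ζ-two eq = z≤n
      ... | one w eq rewrite ζ-one eq = n≢0⇒n>0 λ sum≡0 →
        u≢v (trans (d≡0⇒≡ (trans (sym (L-one eq u)) (m+n≡0⇒m≡0 (L u) sum≡0)))
                   (sym (d≡0⇒≡ (trans (sym (L-one eq v)) (m+n≡0⇒n≡0 (L u) sum≡0)))))

      ζ≤1 : V → ζ T d ≤ 1
      ζ≤1 v with centres v
      ... | one _ eq rewrite ζ-one eq = z≤n
      ... | two _ _ eq _ rewrite ζ-two eq = ≤-refl

      EndCondition : V → V → Set
      EndCondition u v = (ζ T d ≡ 0 → L u + L v ≡ 1) × (ζ T d ≡ 1 → L u + L v ≡ 0)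

      end-sum⇔end-condition : V → ∀ {u v} → (L u + L v ≡ ζ' T d) ⇔ EndCondition u v
      end-sum⇔end-condition v₀ {u} {v} = mk⇔
        (λ e → (λ ζ≡0 → trans e (cong (1 ∸_) ζ≡0)) , (λ ζ≡1 → trans e (cong (1 ∸_) ζ≡1)))
        from
        where
        from : EndCondition u v → L u + L v ≡ ζ' T d
        from (one-centre , two-centres) with centres v₀
        ... | one _ eq     = trans (one-centre (ζ-one eq)) (cong (1 ∸_) (sym (ζ-one eq)))
        ... | two _ _ eq _ = trans (two-centres (ζ-two eq)) (cong (1 ∸_) (sym (ζ-two eq)))

      BranchCondition : V → V → Set
      BranchCondition u v =
        (∀ w → ζ T d ≡ 0 → IsCentre w → DifferentBranches T w u v) ×
        (∀ w w′ → ζ T d ≡ 1 → IsCentre w → IsCentre w′ → w ≢ w′ → OppositeBranches T w w′ u v)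

      tight⇔branch-condition : ∀ {u v} → u ≢ v → Tight u v ⇔ BranchCondition u v
      tight⇔branch-condition {u} {v} u≢v with centres u
      ... | one w₀ eq = mk⇔
        (λ tight → (λ _ _ w-centre → subst (λ c → DifferentBranches T c u v) (sole w-centre)
                                            (Equivalence.to different tight))
                 , λ _ _ ζ≡1 _ _ _ → ⊥-elim (0≢1+n (trans (sym (ζ-one eq)) ζ≡1)))
        (λ (branches , _) → Equivalence.from different (branches w₀ (ζ-one eq) w₀-centre))
        where
        w₀-centre : IsCentre w₀
        w₀-centre = ∈-centers⁻ (subst (w₀ ∈_) (sym eq) (here refl))
        different = tight⇔different-branches eq u≢v
        sole : ∀ {w} → IsCentre w → w₀ ≡ w
        sole w-centre with subst (_ ∈_) eq (∈-centers⁺ w-centre)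
        ... | here refl = refl
      ... | two w₀ w₀′ eq w₀w₀′ = mk⇔
        (λ tight → (λ _ ζ≡0 _ → ⊥-elim (0≢1+n (trans (sym ζ≡0) (ζ-two eq))))
                 , λ _ _ _ w-centre w′-centre w≢w′ →
                     reorient w-centre w′-centre w≢w′ (Equivalence.to opposite tight))
        (λ (_ , branches) → Equivalence.from opposite
           (branches w₀ w₀′ (ζ-two eq) (centre (here refl)) (centre (there (here refl)))
                     (λ { refl → Adj-irrefl w₀w₀′ })))
        where
        opposite = tight⇔opposite-branches eq w₀w₀′
        centre : ∀ {w} → w ∈ w₀ ∷ w₀′ ∷ [] → IsCentre w
        centre w∈ = ∈-centers⁻ (subst (_ ∈_) (sym eq) w∈)
        reorient : ∀ {w w′} → IsCentre w → IsCentre w′ → w ≢ w′ →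
                   OppositeBranches T w₀ w₀′ u v → OppositeBranches T w w′ u v
        reorient w-centre w′-centre w≢w′ ob
          with subst (_ ∈_) eq (∈-centers⁺ w-centre) | subst (_ ∈_) eq (∈-centers⁺ w′-centre)
        ... | here refl         | here refl         = ⊥-elim (w≢w′ refl)
        ... | here refl         | there (here refl) = ob
        ... | there (here refl) | here refl         = OppositeBranches-sym {G = T} ob
        ... | there (here refl) | there (here refl) = ⊥-elim (w≢w′ refl)



-- Orderings of the vertices

module _ {R : A → A → Set} where

  lookup-consecutive : ∀ {xs} → Linked R xs → ∀ i j → toℕ j ≡ suc (toℕ i) → R (lookup xs i) (lookup xs j)
  lookup-consecutive (r ∷ _) fzero    (fsuc fzero) _  = r
  lookup-consecutive (_ ∷ l) (fsuc i) (fsuc j)     eq = lookup-consecutive l i j (suc-injective eq)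

  Linked-tabulate : ∀ {n} (f : Fin n → A) → (∀ i j → toℕ j ≡ suc (toℕ i) → R (f i) (f j)) →
                    Linked R (tabulate f)
  Linked-tabulate {zero}        f _    = []
  Linked-tabulate {suc zero}    f _    = [-]
  Linked-tabulate {suc (suc n)} f cons =
    cons fzero (fsuc fzero) refl ∷ Linked-tabulate (f ∘ fsuc) (λ i j eq → cons (fsuc i) (fsuc j) (cong suc eq))

head-lookup : ∀ (xs : List A) i → toℕ i ≡ 0 → head xs ≡ just (lookup xs i)
head-lookup (_ ∷ _) fzero _ = refl

last-lookup : ∀ (xs : List A) i → toℕ i ≡ length xs ∸ 1 → last xs ≡ just (lookup xs i)
last-lookup (_ ∷ [])     fzero    _  = refl
last-lookup (_ ∷ y ∷ ys) (fsuc i) eq = last-lookup (y ∷ ys) i (suc-injective eq)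

lookup-injective : ∀ {xs : List A} → Unique xs → Injective _≡_ _≡_ (lookup xs)
lookup-injective {xs = _ ∷ _}  _ {fzero}  {fzero}  _  = refl
lookup-injective {xs = _ ∷ ys} u {fzero}  {fsuc j} eq = ⊥-elim (Unique-∷⇒≢ u (∈-lookup j) eq)
lookup-injective {xs = _ ∷ ys} u {fsuc i} {fzero}  eq = ⊥-elim (Unique-∷⇒≢ u (∈-lookup i) (sym eq))
lookup-injective {xs = _ ∷ ys} u {fsuc i} {fsuc j} eq = cong fsuc (lookup-injective (AllPairs.tail u) eq)

record Ordering (n : ℕ) : Set where
  field
    verts  : List (Fin n)
    perm   : verts ↭ allFin n
    first  : Fin n
    final  : Fin n
    starts : head verts ≡ just first
    ends   : last verts ≡ just final

  distinct : Unique verts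
  distinct = Unique-resp-↭ (↭-sym perm) (Unique.allFin⁺ n)

  length-verts : length verts ≡ n
  length-verts = trans (↭-length perm) (length-tabulate {n = n} id)

  ∈-verts : ∀ v → v ∈ verts
  ∈-verts v = ∈-resp-↭ (↭-sym perm) (∈-allFin v)

  first≢final : 2 ≤ n → first ≢ final
  first≢final 2≤n eq with verts | starts | ends | distinct | length-verts
  ... | _ ∷ []     | _ | _ | _ | refl with s≤s () ← 2≤n
  ... | _ ∷ x ∷ xs | s | e | u | _    = Unique-∷⇒≢ u (last⇒∈ (x ∷ xs) e) (trans (just-injective s) eq)

  at : Fin n → Fin n
  at = lookup verts ∘ cast (sym length-verts)

  at-bijective : Bijective _≡_ _≡_ at
  at-bijective = injective , surjective
    where
    injective : Injective _≡_ _≡_ at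
    injective {i} {j} eq =
      toℕ-injective (trans (sym (toℕ-cast _ i)) (trans (cong toℕ (lookup-injective distinct eq)) (toℕ-cast _ j)))
    surjective : ∀ v → ∃ λ i → ∀ {j} → j ≡ i → at j ≡ v
    surjective v = cast length-verts (index v∈) , λ { refl → begin
      lookup verts (cast _ (cast length-verts (index v∈)))
        ≡⟨ cong (lookup verts) (cast-involutive _ length-verts (index v∈)) ⟩
      lookup verts (index v∈)                               ≡⟨ lookup-index v∈ ⟨
      v                                                     ∎ }
      where
      open ≡-Reasoning
      v∈ : v ∈ verts
      v∈ = ∈-verts v

  at-first : ∀ {i} → toℕ i ≡ 0 → at i ≡ first
  at-first {i} eq = just-injective (trans (sym (head-lookup verts _ (trans (toℕ-cast _ i) eq))) starts)

  at-final : ∀ {i} → toℕ i ≡ n ∸ 1 → at i ≡ final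
  at-final {i} eq =
    just-injective (trans (sym (last-lookup verts _ (trans (toℕ-cast _ i) (trans eq (cong (_∸ 1) (sym length-verts))))))
                          ends)

  at-consecutive : ∀ {R : Fin n → Fin n → Set} → Linked R verts →
                   ∀ i j → toℕ j ≡ suc (toℕ i) → R (at i) (at j)
  at-consecutive l i j eq =
    lookup-consecutive l (cast _ i) (cast _ j) (trans (toℕ-cast _ j) (trans eq (cong suc (sym (toℕ-cast _ i)))))

tabulateOrdering : ∀ {n} (x : Fin n → Fin n) → Bijective _≡_ _≡_ x →
                   ∀ {i₀ iₙ} → toℕ i₀ ≡ 0 → toℕ iₙ ≡ n ∸ 1 → Ordering n
tabulateOrdering {n} x (injective , surjective) {i₀} {iₙ} i₀≡0 iₙ≡n-1 = record
  { verts = tabulate x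
  ; perm = ∼bag⇒↭ (unique∧set⇒bag (Unique.tabulate⁺ injective) (Unique.allFin⁺ n) same-members)
  ; first = x i₀
  ; final = x iₙ
  ; starts = trans (head-lookup (tabulate x) _ (trans (toℕ-cast _ i₀) i₀≡0)) (cong just (lookup-tabulate x i₀))
  ; ends = trans (last-lookup (tabulate x) _
                   (trans (toℕ-cast _ iₙ) (trans iₙ≡n-1 (cong (_∸ 1) (sym (length-tabulate x))))))
                 (cong just (lookup-tabulate x iₙ))
  }
  where
  same-members : ∀ {v} → (v ∈ tabulate x) ⇔ (v ∈ allFin n)
  same-members {v} = mk⇔ (λ _ → ∈-allFin v) λ _ →
    subst (_∈ tabulate x) (proj₂ (surjective v) refl) (∈-tabulate⁺ (proj₁ (surjective v)))


-- Spans of hamiltonian colourings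

private
  ⊔-fold-upper : ∀ {y} (xs : List ℕ) → y ∈ xs → y ≤ foldr _⊔_ 0 xs
  ⊔-fold-upper (x ∷ xs) (here refl) = m≤m⊔n x _
  ⊔-fold-upper (x ∷ xs) (there y∈) = ≤-trans (⊔-fold-upper xs y∈) (m≤n⊔m x _)

  ⊔-fold-least : ∀ {M} (xs : List ℕ) → (∀ {y} → y ∈ xs → y ≤ M) → foldr _⊔_ 0 xs ≤ M
  ⊔-fold-least []       _     = z≤n
  ⊔-fold-least (x ∷ xs) bound = ⊔-lub (bound (here refl)) (⊔-fold-least xs (bound ∘ there))

module _ {n : ℕ} (G : Graph n) where

  private
    row : (Fin n → ℕ) → Fin n → List ℕ
    row h u = map (λ v → ∣ h u - h v ∣) (allFin n)

  ∣-∣≤span : ∀ (h : Fin n → ℕ) u v → ∣ h u - h v ∣ ≤ span G h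
  ∣-∣≤span h u v =
    ⊔-fold-upper _ (∈-concatMap⁺ (row h) (Any.map (λ { refl → ∈-map⁺ _ (∈-allFin v) }) (∈-allFin u)))

  span≤ : ∀ (h : Fin n → ℕ) {M} → (∀ u → h u ≤ M) → span G h ≤ M
  span≤ h {M} bound = ⊔-fold-least _ entry≤
    where
    entry≤ : ∀ {y} → y ∈ concatMap (row h) (allFin n) → y ≤ M
    entry≤ y∈ with u , y∈row ← Any.satisfied (∈-concatMap⁻ (row h) {xs = allFin n} y∈)
      with v , _ , refl ← ∈-map⁻ (λ v → ∣ h u - h v ∣) y∈row =
      ≤-trans (∣m-n∣≤m⊔n (h u) (h v)) (⊔-lub (bound u) (bound v))

module HamiltonianSpan {n : ℕ} (G : Graph n) (D : Fin n → Fin n → ℕ) (L : Fin n → ℕ) (ζ ζ′ : ℕ)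
  (D-bound : ∀ u v → D u v ≤ L u + L v + ζ)
  (ζ≤N : ζ ≤ n ∸ 1)
  (ζ′-bound : ∀ {u v} → u ≢ v → ζ′ ≤ L u + L v)
  (2≤n : 2 ≤ n)
  where

  private
    V : Set
    V = Fin n

  N K ΣL : ℕ
  N = n ∸ 1
  K = N ∸ ζ
  ΣL = sum (map L (allFin n))

  Tight : V → V → Set
  Tight u v = D u v ≡ L u + L v + ζ

  excess : V → V → ℕ
  excess u v = L u + L v + ζ ∸ D u v

  L+L : V → V → ℕ
  L+L u v = L u + L v

  sum-L : (o : Ordering n) → sum (map L (Ordering.verts o)) ≡ ΣL
  sum-L o = sum-↭ (map⁺ L (Ordering.perm o))

  sumConsecutive-K : (o : Ordering n) → sumConsecutive (λ _ _ → K) (Ordering.verts o) ≡ N * K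
  sumConsecutive-K o = trans (sumConsecutive-const K verts) (cong (λ m → (m ∸ 1) * K) length-verts)
    where open Ordering o

  module _ (h : V → ℕ) (ham : IsHamColoring G D h) where

    private
      step-bound : ∀ {p q} → p ≢ q → h p ≤ h q → h p + (K + excess p q) ≤ h q + (L p + L q)
      step-bound {p} {q} p≢q hp≤hq = +-cancelʳ-≤ (D p q + ζ) _ _ (begin
        h p + (K + excess p q) + (D p q + ζ)            ≡⟨ regroup₁ (h p) K (excess p q) (D p q) ζ ⟩
        h p + (K + ζ) + (excess p q + D p q)            ≡⟨ cong₂ (λ a b → h p + a + b) (m∸n+n≡m ζ≤N)
                                                                                        (m∸n+n≡m (D-bound p q)) ⟩
        h p + N + (L p + L q + ζ)                       ≤⟨ +-monoˡ-≤ _ (+-monoʳ-≤ (h p) gap) ⟩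
        h p + (D p q + (h q ∸ h p)) + (L p + L q + ζ)   ≡⟨ regroup₂ (h p) (D p q) (h q ∸ h p) (L p + L q) ζ ⟩
        h p + (h q ∸ h p) + (L p + L q) + (D p q + ζ)   ≡⟨ cong (λ x → x + (L p + L q) + (D p q + ζ))
                                                                (m+[n∸m]≡n hp≤hq) ⟩
        h q + (L p + L q) + (D p q + ζ)                 ∎)
        where
        open ≤-Reasoning
        gap : N ≤ D p q + (h q ∸ h p)
        gap = subst (λ t → N ≤ D p q + t) (m≤n⇒∣m-n∣≡n∸m hp≤hq) (ham p q p≢q)
        regroup₁ : ∀ a k x d z → a + (k + x) + (d + z) ≡ a + (k + z) + (x + d)
        regroup₁ = solve-∀
        regroup₂ : ∀ a d g l z → a + (d + g) + (l + z) ≡ a + g + l + (d + z)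
        regroup₂ = solve-∀

    -- Along the vertices sorted by colour each step goes up by at least N − D p q,
    -- which is K − L p − L q + excess p q; the steps telescope.
    ordering-bound : (o : Ordering n) → Linked (_≤_ on h) (Ordering.verts o) → let open Ordering o in
                     N * K + sumConsecutive excess verts + (L first + L final) ≤ span G h + 2 * ΣL
    ordering-bound o sorted = begin
      N * K + S + (L first + L final)                                ≤⟨ +-monoˡ-≤ _ chain ⟩
      span G h + sumConsecutive L+L verts + (L first + L final)      ≡⟨ +-assoc (span G h) _ _ ⟩
      span G h + (sumConsecutive L+L verts + (L first + L final))    ≡⟨ cong (span G h +_) (sumConsecutive-ends L starts ends) ⟩
      span G h + 2 * sum (map L verts)                               ≡⟨ cong (λ s → span G h + 2 * s) (sum-L o) ⟩
      span G h + 2 * ΣL                                              ∎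
      where
      open Ordering o
      open ≤-Reasoning
      S : ℕ
      S = sumConsecutive excess verts
      steps : Linked (λ p q → h p + (K + excess p q) ≤ h q + L+L p q) verts
      steps = Linked.zipWith (λ (p≢q , hp≤hq) → step-bound p≢q hp≤hq) (Linked.AllPairs⇒Linked distinct , sorted)
      total : sumConsecutive (λ p q → K + excess p q) verts ≡ N * K + S
      total = trans (sumConsecutive-+ verts) (cong (_+ S) (sumConsecutive-K o))
      final≤ : h final ≤ h first + span G h
      final≤ = ≤-trans (m≤n+∣n-m∣ (h final) (h first)) (+-monoʳ-≤ (h first) (∣-∣≤span G h first final))
      chain : N * K + S ≤ span G h + sumConsecutive L+L verts
      chain = +-cancelˡ-≤ (h first) _ _ (begin
        h first + (N * K + S)                                    ≡⟨ cong (h first +_) total ⟨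
        h first + sumConsecutive (λ p q → K + excess p q) verts  ≤⟨ telescope-≤ h steps starts ends ⟩
        h final + sumConsecutive L+L verts                       ≤⟨ +-monoˡ-≤ _ final≤ ⟩
        h first + span G h + sumConsecutive L+L verts            ≡⟨ +-assoc (h first) _ _ ⟩
        h first + (span G h + sumConsecutive L+L verts)          ∎)

    sortedOrdering : Σ (Ordering n) λ o → Linked (_≤_ on h) (Ordering.verts o)
    sortedOrdering = build (sort (allFin n)) (sort-↭ (allFin n)) (sort-↗ (allFin n))
      where
      open Sort (On.decTotalOrder ≤-decTotalOrder h)
      build : ∀ xs → xs ↭ allFin n → Linked (_≤_ on h) xs →
              Σ (Ordering n) λ o → Linked (_≤_ on h) (Ordering.verts o)
      build []       p _ with () ← subst (2 ≤_) (sym (trans (↭-length p) (length-tabulate {n = n} id))) 2≤n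
      build (a ∷ as) p s with z , ends ← last-nonempty a as =
        record { verts = a ∷ as ; perm = p ; first = a ; final = z ; starts = refl ; ends = ends } , s

  lowerBound : ∀ h → IsHamColoring G D h → N * K + ζ′ ≤ span G h + 2 * ΣL
  lowerBound h ham with o , sorted ← sortedOrdering h ham =
    ≤-trans (+-mono-≤ (m≤m+n (N * K) _) (ζ′-bound (Ordering.first≢final o 2≤n))) (ordering-bound h ham o sorted)

  record TightOrdering : Set where
    field
      ordering : Ordering n
      tight    : Linked Tight (Ordering.verts ordering)
      end-sum  : L (Ordering.first ordering) + L (Ordering.final ordering) ≡ ζ′

  optimal⇒tightOrdering : ∀ h → IsHamColoring G D h → span G h + 2 * ΣL ≡ N * K + ζ′ → TightOrdering
  optimal⇒tightOrdering h ham optimal with o , sorted ← sortedOrdering h ham = record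
    { ordering = o
    ; tight = Linked.map excess≡0⇒tight (sumConsecutive≡0 S≡0)
    ; end-sum = ≤-antisym (≤-trans (m≤n+m E S) S+E≤ζ′) (ζ′-bound (first≢final 2≤n)) }
    where
    open Ordering o
    S E : ℕ
    S = sumConsecutive excess verts
    E = L first + L final
    S+E≤ζ′ : S + E ≤ ζ′
    S+E≤ζ′ = +-cancelˡ-≤ (N * K) _ _ (begin
      N * K + (S + E)    ≡⟨ +-assoc (N * K) S E ⟨
      N * K + S + E      ≤⟨ ordering-bound h ham o sorted ⟩
      span G h + 2 * ΣL  ≡⟨ optimal ⟩
      N * K + ζ′         ∎)
      where open ≤-Reasoning
    S≡0 : S ≡ 0
    S≡0 = n≤0⇒n≡0 (+-cancelʳ-≤ E S 0 (≤-trans S+E≤ζ′ (ζ′-bound (first≢final 2≤n))))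
    excess≡0⇒tight : ∀ {p q} → excess p q ≡ 0 → Tight p q
    excess≡0⇒tight {p} {q} e = ≤-antisym (D-bound p q) (m∸n≡0⇒m≤n e)

  module Construction
    (D-sym : ∀ u v → D u v ≡ D v u)
    (D-pos : ∀ {u v} → u ≢ v → 1 ≤ D u v)
    (2D≤n : ∀ u v → 2 * D u v ≤ n)
    (4≤n : 4 ≤ n)
    where

    gap : V → V → ℕ
    gap p q = N ∸ D p q

    private
      1+N≡n : suc N ≡ n
      1+N≡n = m+[n∸m]≡n (≤-trans (s≤s z≤n) 4≤n)

      2D≤1+N : ∀ p q → D p q + D p q ≤ suc N
      2D≤1+N p q = subst₂ _≤_ (cong (D p q +_) (+-identityʳ (D p q))) (sym 1+N≡n) (2D≤n p q)

    D≤N : ∀ p q → D p q ≤ N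
    D≤N p q with D p q | 2D≤1+N p q
    ... | zero  | _  = z≤n
    ... | suc k | le = ≤-pred (≤-trans (s≤s (s≤s (m≤m+n k k))) (subst (_≤ suc N) (+-suc (suc k) k) le))

    gap+D : ∀ p q → gap p q + D p q ≡ N
    gap+D p q = m∸n+n≡m (D≤N p q)

    N≤1+2gap : ∀ p q → N ≤ suc (gap p q + gap p q)
    N≤1+2gap p q = +-cancelʳ-≤ N N _ (begin
      N + N                                  ≡⟨ cong₂ _+_ (gap+D p q) (gap+D p q) ⟨
      (gap p q + D p q) + (gap p q + D p q)  ≡⟨ interchange (gap p q) (D p q) (gap p q) (D p q) ⟩
      (gap p q + gap p q) + (D p q + D p q)  ≤⟨ +-monoʳ-≤ (gap p q + gap p q) (2D≤1+N p q) ⟩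
      (gap p q + gap p q) + suc N            ≡⟨ +-suc (gap p q + gap p q) N ⟩
      suc (gap p q + gap p q) + N            ∎)
      where open ≤-Reasoning

    N≤1+gap+gap : ∀ p q r s → N ≤ suc (gap p q + gap r s)
    N≤1+gap+gap p q r s = halve (begin
      N + N                                        ≤⟨ +-mono-≤ (N≤1+2gap p q) (N≤1+2gap r s) ⟩
      suc (gap p q + gap p q) + suc (gap r s + gap r s) ≡⟨ regroup (gap p q) (gap r s) ⟩
      suc (gap p q + gap r s) + suc (gap p q + gap r s) ∎)
      where
      open ≤-Reasoning
      halve : ∀ {m k} → m + m ≤ k + k → m ≤ k
      halve le = ≮⇒≥ (λ k<m → <⇒≱ (+-mono-< k<m k<m) le)
      regroup : ∀ a b → suc (a + a) + suc (b + b) ≡ suc (a + b) + suc (a + b)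
      regroup = solve-∀

    1≤gap : ∀ p q → 1 ≤ gap p q
    1≤gap p q with gap p q | N≤1+2gap p q
    ... | suc _ | _ = s≤s z≤n
    ... | zero  | N≤1 with s≤s () ← ≤-trans (∸-monoˡ-≤ 1 4≤n) N≤1

    N≤gap+gap+gap : ∀ p q r s t u → N ≤ gap p q + gap r s + gap t u
    N≤gap+gap+gap p q r s t u = begin
      N                               ≤⟨ N≤1+gap+gap p q r s ⟩
      suc (gap p q + gap r s)         ≡⟨ +-comm 1 _ ⟩
      gap p q + gap r s + 1           ≤⟨ +-monoʳ-≤ (gap p q + gap r s) (1≤gap t u) ⟩
      gap p q + gap r s + gap t u     ∎
      where open ≤-Reasoning

    colour : List V → V → ℕ
    colour []           v = 0
    colour (_ ∷ [])     v = 0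
    colour (a ∷ b ∷ xs) v = if does (v ≟ a) then 0 else gap a b + colour (b ∷ xs) v

    colour-first : ∀ a xs → colour (a ∷ xs) a ≡ 0
    colour-first a []       = refl
    colour-first a (b ∷ xs) with a ≟ a
    ... | yes _  = refl
    ... | no a≢a = ⊥-elim (a≢a refl)

    colour-head : ∀ {xs a} → head xs ≡ just a → colour xs a ≡ 0
    colour-head {b ∷ xs} refl = colour-first b xs

    colour-other : ∀ {a v} b xs → v ≢ a → colour (a ∷ b ∷ xs) v ≡ gap a b + colour (b ∷ xs) v
    colour-other {a} {v} b xs v≢a with v ≟ a
    ... | yes v≡a = ⊥-elim (v≢a v≡a)
    ... | no  _   = refl

    colour≤ : ∀ xs v → colour xs v ≤ sumConsecutive gap xs
    colour≤ []           v = z≤n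
    colour≤ (_ ∷ [])     v = z≤n
    colour≤ (a ∷ b ∷ xs) v = ≤-trans (if-0≤ (does (v ≟ a))) (+-monoʳ-≤ (gap a b) (colour≤ (b ∷ xs) v))
      where
      if-0≤ : ∀ {m} c → (if c then 0 else m) ≤ m
      if-0≤ true  = z≤n
      if-0≤ false = ≤-refl

    private
      -- A vertex two places after a is separated from it by two gaps (together ≥ N − 1) and D ≥ 1;
      -- one further along is separated by at least three gaps (together ≥ N).
      reach : ∀ a b xs {v} → Unique (a ∷ b ∷ xs) → v ∈ b ∷ xs → N ≤ D a v + (gap a b + colour (b ∷ xs) v)
      reach a b xs _ (here refl) = begin
        N                                      ≡⟨ trans (sym (gap+D a b)) (+-comm (gap a b) (D a b)) ⟩
        D a b + gap a b                        ≡⟨ cong (D a b +_) (+-identityʳ (gap a b)) ⟨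
        D a b + (gap a b + 0)                  ≡⟨ cong (λ t → D a b + (gap a b + t)) (colour-first b xs) ⟨
        D a b + (gap a b + colour (b ∷ xs) b)  ∎
        where open ≤-Reasoning
      reach a b (c ∷ ys) distinct (there (here refl)) = begin
        N                                          ≤⟨ N≤1+gap+gap a b b c ⟩
        1 + (gap a b + gap b c)                    ≤⟨ +-monoˡ-≤ _ (D-pos (Unique-∷⇒≢ distinct (there (here refl)))) ⟩
        D a c + (gap a b + gap b c)                ≡⟨ cong (λ t → D a c + (gap a b + t)) colour-c ⟨
        D a c + (gap a b + colour (b ∷ c ∷ ys) c)  ∎
        where
        open ≤-Reasoning
        c≢b : c ≢ b
        c≢b c≡b = Unique-∷⇒≢ (AllPairs.tail distinct) (here (sym c≡b)) refl
        colour-c : colour (b ∷ c ∷ ys) c ≡ gap b c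
        colour-c = trans (colour-other c ys c≢b) (trans (cong (gap b c +_) (colour-first c ys)) (+-identityʳ (gap b c)))
      reach a b (c ∷ e ∷ zs) {v} distinct (there (there v∈)) = begin
        N                                                ≤⟨ N≤gap+gap+gap a b b c c e ⟩
        gap a b + gap b c + gap c e                      ≤⟨ +-monoʳ-≤ (gap a b + gap b c) (m≤m+n (gap c e) _) ⟩
        gap a b + gap b c + (gap c e + colour (e ∷ zs) v) ≡⟨ cong (gap a b + gap b c +_) (colour-other e zs v≢c) ⟨
        gap a b + gap b c + colour (c ∷ e ∷ zs) v        ≡⟨ +-assoc (gap a b) (gap b c) _ ⟩
        gap a b + (gap b c + colour (c ∷ e ∷ zs) v)      ≡⟨ cong (gap a b +_) (colour-other c (e ∷ zs) v≢b) ⟨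
        gap a b + colour (b ∷ c ∷ e ∷ zs) v              ≤⟨ m≤n+m _ (D a v) ⟩
        D a v + (gap a b + colour (b ∷ c ∷ e ∷ zs) v)    ∎
        where
        open ≤-Reasoning
        v≢b : v ≢ b
        v≢b v≡b = Unique-∷⇒≢ (AllPairs.tail distinct) (there v∈) (sym v≡b)
        v≢c : v ≢ c
        v≢c v≡c = Unique-∷⇒≢ (AllPairs.tail (AllPairs.tail distinct)) v∈ (sym v≡c)

    colour-from-first : ∀ {a b xs v} → Unique (a ∷ b ∷ xs) → v ∈ b ∷ xs → N ≤ D a v + colour (a ∷ b ∷ xs) v
    colour-from-first {a} {b} {xs} {v} distinct v∈ =
      subst (λ c → N ≤ D a v + c) (sym (colour-other b xs (Unique-∷⇒≢ distinct v∈ ∘ sym))) (reach a b xs distinct v∈)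

    colour-hamiltonian : ∀ xs {u v} → Unique xs → u ∈ xs → v ∈ xs → u ≢ v →
                         N ≤ D u v + ∣ colour xs u - colour xs v ∣
    colour-hamiltonian (a ∷ xs) _ (here refl) (here refl) u≢v = ⊥-elim (u≢v refl)
    colour-hamiltonian (a ∷ b ∷ xs) {v = v} distinct (here refl) (there v∈) _
      rewrite colour-first a (b ∷ xs) = colour-from-first distinct v∈
    colour-hamiltonian (a ∷ b ∷ xs) {u} distinct (there u∈) (here refl) _
      rewrite colour-first a (b ∷ xs) | ∣-∣-identityʳ (colour (a ∷ b ∷ xs) u) | D-sym u a =
      colour-from-first distinct u∈
    colour-hamiltonian (a ∷ b ∷ xs) {u} {v} distinct (there u∈) (there v∈) u≢v
      rewrite colour-other b xs (λ u≡a → Unique-∷⇒≢ distinct u∈ (sym u≡a))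
            | colour-other b xs (λ v≡a → Unique-∷⇒≢ distinct v∈ (sym v≡a))
            | ∣m+n-m+o∣≡∣n-o∣ (gap a b) (colour (b ∷ xs) u) (colour (b ∷ xs) v) =
      colour-hamiltonian (b ∷ xs) (AllPairs.tail distinct) u∈ v∈ u≢v

    colour-steps : ∀ xs → Unique xs → Linked (λ p q → colour xs q ≡ colour xs p + gap p q) xs
    colour-steps []           _ = []
    colour-steps (_ ∷ [])     _ = [-]
    colour-steps (a ∷ b ∷ xs) distinct@(a≢ ∷ rest) =
      first ∷ Linked-map-All shift (All.map ≢-sym a≢) (colour-steps (b ∷ xs) rest)
      where
      first : colour (a ∷ b ∷ xs) b ≡ colour (a ∷ b ∷ xs) a + gap a b
      first = begin
        colour (a ∷ b ∷ xs) b          ≡⟨ colour-other b xs (Unique-∷⇒≢ distinct (here refl) ∘ sym) ⟩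
        gap a b + colour (b ∷ xs) b    ≡⟨ cong (gap a b +_) (colour-first b xs) ⟩
        gap a b + 0                    ≡⟨ +-identityʳ (gap a b) ⟩
        gap a b                        ≡⟨ cong (_+ gap a b) (colour-first a (b ∷ xs)) ⟨
        colour (a ∷ b ∷ xs) a + gap a b ∎
        where open ≡-Reasoning
      shift : ∀ {p q} → p ≢ a → q ≢ a → colour (b ∷ xs) q ≡ colour (b ∷ xs) p + gap p q →
              colour (a ∷ b ∷ xs) q ≡ colour (a ∷ b ∷ xs) p + gap p q
      shift {p} {q} p≢a q≢a step = begin
        colour (a ∷ b ∷ xs) q                   ≡⟨ colour-other b xs q≢a ⟩
        gap a b + colour (b ∷ xs) q             ≡⟨ cong (gap a b +_) step ⟩
        gap a b + (colour (b ∷ xs) p + gap p q) ≡⟨ +-assoc (gap a b) _ _ ⟨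
        gap a b + colour (b ∷ xs) p + gap p q   ≡⟨ cong (_+ gap p q) (colour-other b xs p≢a) ⟨
        colour (a ∷ b ∷ xs) p + gap p q         ∎
        where open ≡-Reasoning

    gap+L+L≡K : ∀ {p q} → Tight p q → gap p q + L+L p q ≡ K
    gap+L+L≡K {p} {q} tight = begin
      N ∸ D p q + L+L p q              ≡⟨ cong (λ t → N ∸ t + L+L p q) (trans tight (+-comm (L+L p q) ζ)) ⟩
      N ∸ (ζ + L+L p q) + L+L p q      ≡⟨ cong (_+ L+L p q) (∸-+-assoc N ζ (L+L p q)) ⟨
      K ∸ L+L p q + L+L p q            ≡⟨ m∸n+n≡m (m+n≤o⇒m≤o∸n (L+L p q) (subst (_≤ N) tight (D≤N p q))) ⟩
      K                                ∎
      where open ≡-Reasoning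

    module _ (t : TightOrdering) where

      open TightOrdering t
      open Ordering ordering

      h : V → ℕ
      h = colour verts

      h-hamiltonian : IsHamColoring G D h
      h-hamiltonian u v = colour-hamiltonian verts distinct (∈-verts u) (∈-verts v)

      total-gap : sumConsecutive gap verts + 2 * ΣL ≡ N * K + ζ′
      total-gap = begin
        Sg + 2 * ΣL                                          ≡⟨ cong (λ s → Sg + 2 * s) (sum-L ordering) ⟨
        Sg + 2 * sum (map L verts)                           ≡⟨ cong (Sg +_) (sumConsecutive-ends L starts ends) ⟨
        Sg + (SL + (L first + L final))                      ≡⟨ +-assoc Sg SL _ ⟨
        Sg + SL + (L first + L final)                        ≡⟨ cong₂ _+_ (sym (sumConsecutive-+ verts)) end-sum ⟩
        sumConsecutive (λ p q → gap p q + L+L p q) verts + ζ′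
          ≡⟨ cong (_+ ζ′) (sumConsecutive-cong (Linked.map gap+L+L≡K tight)) ⟩
        sumConsecutive (λ _ _ → K) verts + ζ′                ≡⟨ cong (_+ ζ′) (sumConsecutive-K ordering) ⟩
        N * K + ζ′                                           ∎
        where
        open ≡-Reasoning
        Sg SL : ℕ
        Sg = sumConsecutive gap verts
        SL = sumConsecutive L+L verts

      span-h : span G h + 2 * ΣL ≡ N * K + ζ′
      span-h = ≤-antisym
        (≤-trans (+-monoˡ-≤ (2 * ΣL) (span≤ G h (colour≤ verts))) (≤-reflexive total-gap))
        (lowerBound h h-hamiltonian)

      h-optimal : IsOptimalHamColoring G D h
      h-optimal = h-hamiltonian , λ h′ ham′ →
        +-cancelʳ-≤ (2 * ΣL) _ _ (≤-trans (≤-reflexive span-h) (lowerBound h′ ham′))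

      h-first : h first ≡ 0
      h-first = colour-head starts

      h-steps : Linked (λ p q → h q + ζ + L p + L q ≡ h p + N) verts
      h-steps = Linked.zipWith step (colour-steps verts distinct , tight)
        where
        step : ∀ {p q} → (h q ≡ h p + gap p q) × Tight p q → h q + ζ + L p + L q ≡ h p + N
        step {p} {q} (hq , tpq) = begin
          h q + ζ + L p + L q              ≡⟨ regroup (h q) ζ (L p) (L q) ⟩
          h q + (L p + L q + ζ)            ≡⟨ cong₂ _+_ hq (sym tpq) ⟩
          h p + gap p q + D p q            ≡⟨ +-assoc (h p) (gap p q) (D p q) ⟩
          h p + (gap p q + D p q)          ≡⟨ cong (h p +_) (gap+D p q) ⟩
          h p + N                          ∎
          where
          open ≡-Reasoning
          regroup : ∀ a z x y → a + z + x + y ≡ a + (x + y + z)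
          regroup = solve-∀


-- Hamiltonian colourings of trees

consecutive-≢ : ∀ {n} {x : Fin n → Fin n} → Bijective _≡_ _≡_ x →
                ∀ {i j} → toℕ j ≡ suc (toℕ i) → x i ≢ x j
consecutive-≢ (injective , _) {i} j≡1+i eq = <⇒≢ (n<1+n (toℕ i)) (trans (cong toℕ (injective eq)) j≡1+i)

module HamiltonianTree {n : ℕ} (T : Graph n) (d D : Fin n → Fin n → ℕ)
  (tree : IsTree T) (isd : IsDistance T d) (isD : IsDetour T D)
  (4≤n : 4 ≤ n) (2d≤n : ∀ u v → 2 * d u v ≤ n)
  where

  open Tree T tree
  open Metric d isd

  private
    d≤n : ∀ u v → d u v ≤ n
    d≤n u v = ≤-trans (m≤m+n (d u v) (d u v + 0)) (2d≤n u v)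

  open NearestCentre D isD d≤n

  private
    0<n : 0 < n
    0<n = ≤-trans (s≤s z≤n) 4≤n

    N<n : n ∸ 1 < n
    N<n = ≤-reflexive (m+[n∸m]≡n 0<n)

    i₀ iₙ : Fin n
    i₀ = fromℕ< 0<n
    iₙ = fromℕ< N<n

    ζ≤N : ζ T d ≤ n ∸ 1
    ζ≤N = ≤-trans (ζ≤1 i₀) (∸-monoˡ-≤ 1 (≤-trans (s≤s (s≤s z≤n)) 4≤n))

  open HamiltonianSpan T D L (ζ T d) (ζ' T d) D-bound ζ≤N ζ′≤L+L (≤-trans (s≤s (s≤s z≤n)) 4≤n) public
  open Construction
    (λ u v → trans (detour≡d isD u v) (trans (d-sym u v) (sym (detour≡d isD v u))))
    (λ {u} {v} u≢v → n≢0⇒n>0 λ D≡0 → u≢v (d≡0⇒≡ (trans (sym (detour≡d isD u v)) D≡0)))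
    (λ u v → subst (λ t → 2 * t ≤ n) (sym (detour≡d isD u v)) (2d≤n u v))
    4≤n
    public

  conditions : (t : TightOrdering) → OrderingConditions T d D (Ordering.at (TightOrdering.ordering t))
  conditions t = at-bijective , end-condition , branches
    where
    open TightOrdering t
    open Ordering ordering
    end-condition : ∀ i j → toℕ i ≡ 0 → toℕ j ≡ n ∸ 1 → EndCondition (at i) (at j)
    end-condition i j i≡0 j≡N = Equivalence.to (end-sum⇔end-condition i₀)
      (subst₂ (λ a b → L a + L b ≡ ζ' T d) (sym (at-first i≡0)) (sym (at-final j≡N)) end-sum)
    branches : ∀ i j → toℕ j ≡ suc (toℕ i) → BranchCondition (at i) (at j)
    branches i j j≡1+i =
      Equivalence.to (tight⇔branch-condition (consecutive-≢ at-bijective j≡1+i)) (at-consecutive tight i j j≡1+i)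

  tightOrdering : ∀ x → OrderingConditions T d D x → TightOrdering
  tightOrdering x (bijective , ends , branches) = record
    { ordering = tabulateOrdering x bijective (toℕ-fromℕ< 0<n) (toℕ-fromℕ< N<n)
    ; tight = Linked-tabulate x λ i j j≡1+i →
        Equivalence.from (tight⇔branch-condition (consecutive-≢ bijective j≡1+i)) (branches i j j≡1+i)
    ; end-sum = Equivalence.from (end-sum⇔end-condition i₀) (ends i₀ iₙ (toℕ-fromℕ< 0<n) (toℕ-fromℕ< N<n)) }

  colouring-from-ordering : ∀ x (oc : OrderingConditions T d D x) → ColoringFromOrdering T d D x (h (tightOrdering x oc))
  colouring-from-ordering x oc = coloured-first , coloured-steps
    where
    t : TightOrdering
    t = tightOrdering x oc
    coloured-first : ∀ i → toℕ i ≡ 0 → h t (x i) ≡ 0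
    coloured-first i i≡0 = trans (cong (h t ∘ x) (toℕ-injective (trans i≡0 (sym (toℕ-fromℕ< 0<n))))) (h-first t)
    coloured-steps : ∀ i j → toℕ j ≡ suc (toℕ i) → h t (x j) + ζ T d + L (x i) + L (x j) ≡ h t (x i) + (n ∸ 1)
    coloured-steps i j j≡1+i = subst₂ (λ a b → h t b + ζ T d + L a + L b ≡ h t a + (n ∸ 1))
      (lookup-tabulate x i) (lookup-tabulate x j) (Ordering.at-consecutive (TightOrdering.ordering t) (h-steps t) i j j≡1+i)

corollary1 : (n : ℕ) (T : Graph n) (d D : Fin n → Fin n → ℕ) →
    IsTree T → IsDistance T d → IsDetour T D →
    4 ≤ n → MaxDegree≥3 T → (∀ u v → 2 * d u v ≤ n) →
    ((Σ ℕ λ k → IsHC T D k × k + 2 * 𝓛W T d D ≡ (n ∸ 1) * (n ∸ 1 ∸ ζ T d) + ζ' T d)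
       ⇔ (Σ (Fin n → Fin n) λ x → OrderingConditions T d D x))
    × (∀ x → OrderingConditions T d D x →
         Σ (Fin n → ℕ) λ h → ColoringFromOrdering T d D x h × IsOptimalHamColoring T D h)
corollary1 n T d D tree isd isD 4≤n _ 2d≤n = mk⇔ optimal⇒ordering ordering⇒optimal , optimal-colouring
  where
  open HamiltonianTree T d D tree isd isD 4≤n 2d≤n
  optimal⇒ordering : (Σ ℕ λ k → IsHC T D k × k + 2 * 𝓛W T d D ≡ (n ∸ 1) * (n ∸ 1 ∸ ζ T d) + ζ' T d) →
                     Σ (Fin n → Fin n) λ x → OrderingConditions T d D x
  optimal⇒ordering (k , ((h , ham , span≡k) , _) , hc) =
    _ , conditions (optimal⇒tightOrdering h ham (trans (cong (_+ 2 * ΣL) span≡k) hc))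
  ordering⇒optimal : (Σ (Fin n → Fin n) λ x → OrderingConditions T d D x) →
                     Σ ℕ λ k → IsHC T D k × k + 2 * 𝓛W T d D ≡ (n ∸ 1) * (n ∸ 1 ∸ ζ T d) + ζ' T d
  ordering⇒optimal (x , oc) = span T (h t) , ((h t , h-optimal t .proj₁ , refl) , h-optimal t .proj₂) , span-h t
    where
    t : TightOrdering
    t = tightOrdering x oc
  optimal-colouring : ∀ x → OrderingConditions T d D x →
                      Σ (Fin n → ℕ) λ h → ColoringFromOrdering T d D x h × IsOptimalHamColoring T D h
  optimal-colouring x oc = h (tightOrdering x oc) , colouring-from-ordering x oc , h-optimal (tightOrdering x oc)
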